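{- Let $n\in\mathbb{N}=\{1,2,\dots\}$ and $m\geq 3$. Then \[ B_n(d_1,d_2,\dots, d_n)= n!\cdot e_{m+2,n}, \] where $d_j=-(j-1)!\cdot \sigma'_m(j)$ for $j\ge1$.
   Context: $B_n$ is the $n$-th complete exponential Bell polynomial, defined by $\exp\big(\sum_{j\ge1}x_j t^j/j!\big)=\sum_{n\ge0}B_n(x_1,\dots,x_n)t^n/n!$. $\sigma'_m(j)$ is the sum of the positive divisors $d$ of $j$ with $d\equiv0,1$ or $m-1\pmod m$. With $P_{g,k}=\frac{k((g-2)k-(g-4))}{2}$ and $Q_{g,k}=\frac{k((g-2)k+(g-4))}{2}$, $e_{g,n}=1$ if $n=0$, $e_{g,n}=(-1)^k$ if $n=P_{g,k}$ or $n=Q_{g,k}$ for some $k\in\mathbb{N}$, and $e_{g,n}=0$ otherwise. -}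

module Defs where

open import Data.Nat as ℕ using (ℕ; zero; suc; _∸_; _≟_)
open import Data.Nat.Divisibility using (_∣_; _∣?_)
open import Data.Nat.Combinatorics using (_C_)
open import Data.Nat.DivMod using (_/_)
open import Data.Integer as ℤ using (ℤ; +_; -_; -1ℤ)
open import Data.List using (List; []; _∷_; upTo; map; filter)
open import Data.Nat.ListAction using () renaming (sum to sumℕ)
open import Data.Vec using (Vec; []; _∷_; head; zipWith; foldr; allFin)
open import Data.Fin using (toℕ)
open import Data.Maybe using (Maybe; just; nothing; maybe)
open import Data.Sum using (_⊎_)
open import Relation.Nullary.Decidable using (_⊎-dec_; _×-dec_; yes; no)
open import Data.Nat using (_!)

-- Complete exponential Bell polynomials, via the recurrence
--   B_0 = 1,  B_{n+1}(x) = Σ_{k=0}^{n} C(n,k) x_{k+1} B_{n-k}(x),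
-- i.e. the coefficient identity obtained from
--   d/dt exp(Σ x_j t^j/j!) = (Σ x_{j+1} t^j/j!) · exp(Σ x_j t^j/j!).
-- The sequence x is given as a function ℕ → ℤ with x j = x_j (x 0 unused).

-- bellVec n x = [B_n, B_{n-1}, ..., B_0]
bellVec : (n : ℕ) → (ℕ → ℤ) → Vec ℤ (suc n)
bellVec zero x = (+ 1) ∷ []
bellVec (suc n) x = next ∷ prev
  where
  prev : Vec ℤ (suc n)
  prev = bellVec n x
  next : ℤ
  next = foldr (λ _ → ℤ) ℤ._+_ (+ 0)
           (zipWith (λ k b → (+ (n C toℕ k)) ℤ.* x (suc (toℕ k)) ℤ.* b)
                    (allFin (suc n)) prev)

Bell : ℕ → (ℕ → ℤ) → ℤ
Bell n x = head (bellVec n x)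

-- σ'_m(j): sum of positive divisors d of j with d ≡ 0, 1 or m-1 (mod m),
-- i.e. m ∣ d, m ∣ d - 1, or m ∣ d + 1 (d ≥ 1).
σ′ : ℕ → ℕ → ℕ
σ′ m j = sumℕ (filter (λ d → d ∣? j ×-dec (m ∣? d ⊎-dec (m ∣? (d ∸ 1) ⊎-dec m ∣? suc d)))
                      (map suc (upTo j)))

-- generalized polygonal numbers (g ≥ 4, k ≥ 1 so no truncation occurs)
P : ℕ → ℕ → ℕ
P g k = (k ℕ.* ((g ∸ 2) ℕ.* k ∸ (g ∸ 4))) / 2

Q : ℕ → ℕ → ℕ
Q g k = (k ℕ.* ((g ∸ 2) ℕ.* k ℕ.+ (g ∸ 4))) / 2

findK : ℕ → ℕ → List ℕ → Maybe ℕ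
findK g n [] = nothing
findK g n (k ∷ ks) with (P g k ≟ n) ⊎-dec (Q g k ≟ n)
... | yes _ = just k
... | no _ = findK g n ks

-- e_{g,n}: 1 if n = 0; (-1)^k if n = P_{g,k} or n = Q_{g,k} for some k ≥ 1;
-- 0 otherwise.  For g ≥ 4 and n ≥ 1 such k satisfies k ≤ n (P_{g,k} ≥ k), so
-- searching k ∈ {1,…,n} is exhaustive.
e : ℕ → ℕ → ℤ
e g zero = + 1
e g (suc n) = maybe (λ k → -1ℤ ℤ.^ k) (+ 0) (findK g (suc n) (map suc (upTo (suc n))))

dseq : ℕ → ℕ → ℤ
dseq m j = - (+ ((j ∸ 1) !) ℤ.* + (σ′ m j))

-- Put g = m + 2 and E = Σ_n e_{g,n} Xⁿ.  Jacobi's triple product identity with q = Xᵐ and z = X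
-- gives E = ∏_{k ≥ 0} (1 - X^{mk+1}) (1 - X^{mk+m-1}) (1 - X^{m(k+1)}), the product of the 1 - X^d
-- over the d ≥ 1 with d ≡ 0, ±1 (mod m); these residues are distinct as m ≥ 3.  Since
-- X (1 - X^d)′ / (1 - X^d) = -Σ_{j ≥ 1} d X^{dj}, we get X E′ = -S E with S = Σ_n σ′_m(n) Xⁿ, that is
-- E = exp (Σ_j d_j X^j / j!), and the Bell recurrence B_{n+1} = Σ_k C(n,k) d_{k+1} B_{n-k} gives
-- B_n(d_1, …, d_n) = n! e_{g,n}.
--
-- Everything is done with finite products modulo powers of X.  By Cauchy's q-binomial theorem,
-- ∏_{i<2M} (q^M - X qⁱ) = Σ_{a+b=2M} [2M choose a]_q (-1)^a q^{a(a-1)/2} X^a q^{Mb}.  The left side is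
-- a monomial times ∏_{k<M} (1 - X^{mk+1}) (1 - X^{mk+m-1}); after multiplying by (q; q)_M, each term
-- on the right is that monomial times ±X^θ (θ a generalised polygonal number) up to higher powers
-- of X, which yields the triple product identity modulo X^{M+1}.

module Submission where

open import Data.Nat using (ℕ)

module RangeSum where

  open import Algebra.Bundles using (CommutativeMonoid; Semiring)
  open import Data.Nat as ℕ using (ℕ; zero; suc; _<_; _∸_; z≤n; s≤s)
  import Data.Nat.Properties as ℕ
  open import Function using (_∘_)
  import Relation.Binary.PropositionalEquality as ≡

  -- Sums indexed by ℕ rather than by Fin n (as in Algebra.Properties.Monoid.Sum), which keeps the
  -- index arithmetic of splitting, reversing and regrouping ranges in ℕ.
  module Sum {c ℓ} (M : CommutativeMonoid c ℓ) where

    open CommutativeMonoid M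
    open import Algebra.Definitions.RawMonoid rawMonoid using (_×_)
    open import Algebra.Properties.CommutativeSemigroup commutativeSemigroup using (interchange)
    open import Relation.Binary.Reasoning.Setoid setoid

    ∑ : ℕ → (ℕ → Carrier) → Carrier
    ∑ zero f = ε
    ∑ (suc n) f = f 0 ∙ ∑ n (f ∘ suc)

    ∑-cong : ∀ n {f g} → (∀ {k} → k < n → f k ≈ g k) → ∑ n f ≈ ∑ n g
    ∑-cong zero p = refl
    ∑-cong (suc n) p = ∙-cong (p (s≤s z≤n)) (∑-cong n (p ∘ s≤s))

    ∑-ε : ∀ n {f} → (∀ {k} → k < n → f k ≈ ε) → ∑ n f ≈ ε
    ∑-ε zero p = refl
    ∑-ε (suc n) p = trans (∙-cong (p (s≤s z≤n)) (∑-ε n (p ∘ s≤s))) (identityˡ ε)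

    ∑-const : ∀ n x → ∑ n (λ _ → x) ≈ n × x
    ∑-const zero x = refl
    ∑-const (suc n) x = ∙-congˡ (∑-const n x)

    ∑-split : ∀ a b f → ∑ (a ℕ.+ b) f ≈ ∑ a f ∙ ∑ b (λ k → f (a ℕ.+ k))
    ∑-split zero b f = sym (identityˡ _)
    ∑-split (suc a) b f = trans (∙-congˡ (∑-split a b (f ∘ suc))) (sym (assoc _ _ _))

    ∑-last : ∀ n f → ∑ (suc n) f ≈ ∑ n f ∙ f n
    ∑-last n f = begin
      ∑ (suc n) f                    ≡⟨ ≡.cong (λ k → ∑ k f) (ℕ.+-comm 1 n) ⟩
      ∑ (n ℕ.+ 1) f                  ≈⟨ ∑-split n 1 f ⟩
      ∑ n f ∙ (f (n ℕ.+ 0) ∙ ε)      ≈⟨ ∙-congˡ (identityʳ _) ⟩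
      ∑ n f ∙ f (n ℕ.+ 0)            ≡⟨ ≡.cong (λ k → ∑ n f ∙ f k) (ℕ.+-identityʳ n) ⟩
      ∑ n f ∙ f n                    ∎

    ∑-distrib : ∀ n f g → ∑ n (λ k → f k ∙ g k) ≈ ∑ n f ∙ ∑ n g
    ∑-distrib zero f g = sym (identityˡ ε)
    ∑-distrib (suc n) f g =
      trans (∙-congˡ (∑-distrib n (f ∘ suc) (g ∘ suc))) (interchange _ _ _ _)

    ∑-reverse : ∀ n f → ∑ n (λ k → f (n ∸ suc k)) ≈ ∑ n f
    ∑-reverse zero f = refl
    ∑-reverse (suc n) f = begin
      f n ∙ ∑ n (λ k → f (n ∸ suc k))  ≈⟨ ∙-congˡ (∑-reverse n f) ⟩
      f n ∙ ∑ n f                      ≈⟨ comm _ _ ⟩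
      ∑ n f ∙ f n                      ≈⟨ sym (∑-last n f) ⟩
      ∑ (suc n) f                      ∎

    ∑-blocks : ∀ b n f → ∑ (b ℕ.* n) f ≈ ∑ n (λ k → ∑ b (λ j → f (b ℕ.* k ℕ.+ j)))
    ∑-blocks b zero f = reflexive (≡.cong (λ k → ∑ k f) (ℕ.*-zeroʳ b))
    ∑-blocks b (suc n) f = begin
      ∑ (b ℕ.* suc n) f
        ≡⟨ ≡.cong (λ k → ∑ k f) (ℕ.*-suc b n) ⟩
      ∑ (b ℕ.+ b ℕ.* n) f
        ≈⟨ ∑-split b (b ℕ.* n) f ⟩
      ∑ b f ∙ ∑ (b ℕ.* n) (λ j → f (b ℕ.+ j))
        ≈⟨ ∙-cong (∑-cong b (λ {j} _ → reflexive (≡.cong f (≡.cong (ℕ._+ j) (≡.sym (ℕ.*-zeroʳ b))))))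
                  (∑-blocks b n (λ j → f (b ℕ.+ j))) ⟩
      ∑ b (λ j → f (b ℕ.* 0 ℕ.+ j)) ∙ ∑ n (λ k → ∑ b (λ j → f (b ℕ.+ (b ℕ.* k ℕ.+ j))))
        ≈⟨ ∙-congˡ (∑-cong n (λ {k} _ → ∑-cong b (λ {j} _ → reflexive (≡.cong f (shift k j))))) ⟩
      ∑ (suc n) (λ k → ∑ b (λ j → f (b ℕ.* k ℕ.+ j)))
        ∎
      where
      shift : ∀ k j → b ℕ.+ (b ℕ.* k ℕ.+ j) ≡.≡ b ℕ.* suc k ℕ.+ j
      shift k j = ≡.trans (≡.sym (ℕ.+-assoc b (b ℕ.* k) j)) (≡.cong (ℕ._+ j) (≡.sym (ℕ.*-suc b k)))

  module SumDistrib {c ℓ} (R : Semiring c ℓ) where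

    open Semiring R
    open Sum +-commutativeMonoid using (∑)

    ∑-distribʳ : ∀ n f x → ∑ n f * x ≈ ∑ n (λ k → f k * x)
    ∑-distribʳ zero f x = zeroˡ x
    ∑-distribʳ (suc n) f x = trans (distribʳ x (f 0) _) (+-congˡ (∑-distribʳ n (f ∘ suc) x))

    ∑-distribˡ : ∀ n f x → x * ∑ n f ≈ ∑ n (λ k → x * f k)
    ∑-distribˡ zero f x = zeroʳ x
    ∑-distribˡ (suc n) f x = trans (distribˡ x (f 0) _) (+-congˡ (∑-distribˡ n (f ∘ suc) x))

open import Algebra.Bundles using (CommutativeRing)
import Data.Integer.Properties as ℤ
import Data.Nat.Properties as ℕ
open import Function using (_∘_)
open import Relation.Binary.PropositionalEquality
import Relation.Binary.Reasoning.Setoid as SetoidReasoning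

module PowerSeries where

  open import Algebra.Consequences.Setoid using (comm∧idˡ⇒id; comm∧distrˡ⇒distr)
  import Algebra.Solver.Ring
  import Algebra.Solver.Ring.AlmostCommutativeRing as ACR
  open import Data.Integer as ℤ using (ℤ; _+_; _*_; -_; 0ℤ; 1ℤ)
  open import Data.Integer.Tactic.RingSolver using (solve-∀)
  open import Data.Maybe using (Maybe; just; nothing)
  open import Data.Nat as ℕ using (ℕ; zero; suc; _≤_; z≤n; s≤s)
  open import Data.Product using (_,_)
  open import Level using (0ℓ)
  open import Relation.Binary.Bundles using (Setoid)
  open import Relation.Nullary using (yes; no)

  Series : Set
  Series = ℕ → ℤ

  -- A record rather than a pointwise function type, so that both series can be inferred from a proof.
  infix 4 _≋_
  record _≋_ (f g : Series) : Set where
    constructor pointwise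
    field coeff : ∀ n → f n ≡ g n
  open _≋_ public

  ≋-refl : ∀ {f} → f ≋ f
  ≋-refl = pointwise λ _ → refl

  ≋-sym : ∀ {f g} → f ≋ g → g ≋ f
  ≋-sym p = pointwise λ n → sym (coeff p n)

  ≋-trans : ∀ {f g h} → f ≋ g → g ≋ h → f ≋ h
  ≋-trans p q = pointwise λ n → trans (coeff p n) (coeff q n)

  κ : ℤ → Series
  κ c zero = c
  κ c (suc _) = 0ℤ

  0ₛ 1ₛ : Series
  0ₛ _ = 0ℤ
  1ₛ = κ 1ℤ

  infixl 6 _⊕_
  infixl 7 _⊛_
  infix 8 ⊝_

  _⊕_ : Series → Series → Series
  (f ⊕ g) n = f n + g n

  ⊝_ : Series → Series
  (⊝ f) n = - f n

  _⊛_ : Series → Series → Series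
  (f ⊛ g) zero = f 0 * g 0
  (f ⊛ g) (suc n) = f 0 * g (suc n) + (f ∘ suc ⊛ g) n

  ⊛-coeff-cong : ∀ n {f f′ g g′} → (∀ {i} → i ≤ n → f i ≡ f′ i) → (∀ {i} → i ≤ n → g i ≡ g′ i) →
                 (f ⊛ g) n ≡ (f′ ⊛ g′) n
  ⊛-coeff-cong zero p q = cong₂ _*_ (p z≤n) (q z≤n)
  ⊛-coeff-cong (suc n) p q =
    cong₂ _+_ (cong₂ _*_ (p z≤n) (q ℕ.≤-refl))
              (⊛-coeff-cong n (p ∘ s≤s) (q ∘ ℕ.m≤n⇒m≤1+n))

  private
    infixl 7 _⊙_
    _⊙_ : ℤ → Series → Series
    (c ⊙ f) n = c * f n

    ⊛-zeroˡ : ∀ g n → (0ₛ ⊛ g) n ≡ 0ℤ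
    ⊛-zeroˡ g zero = ℤ.*-zeroˡ (g 0)
    ⊛-zeroˡ g (suc n) = cong₂ _+_ (ℤ.*-zeroˡ (g (suc n))) (⊛-zeroˡ g n)

    ⊛-identityˡ : ∀ g n → (1ₛ ⊛ g) n ≡ g n
    ⊛-identityˡ g zero = ℤ.*-identityˡ (g 0)
    ⊛-identityˡ g (suc n) =
      trans (cong₂ _+_ (ℤ.*-identityˡ (g (suc n))) (⊛-zeroˡ g n)) (ℤ.+-identityʳ _)

    ⊛-distribʳ : ∀ f f′ g n → ((f ⊕ f′) ⊛ g) n ≡ (f ⊛ g ⊕ f′ ⊛ g) n
    ⊛-distribʳ f f′ g zero = ℤ.*-distribʳ-+ (g 0) (f 0) (f′ 0)
    ⊛-distribʳ f f′ g (suc n) =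
      trans (cong ((f 0 + f′ 0) * g (suc n) +_) (⊛-distribʳ (f ∘ suc) (f′ ∘ suc) g n))
            (rearrange (f 0) (f′ 0) (g (suc n)) _ _)
      where
      rearrange : ∀ a b c x y → (a + b) * c + (x + y) ≡ (a * c + x) + (b * c + y)
      rearrange = solve-∀

    ⊛-scalˡ : ∀ c f g n → (c ⊙ f ⊛ g) n ≡ c * (f ⊛ g) n
    ⊛-scalˡ c f g zero = ℤ.*-assoc c (f 0) (g 0)
    ⊛-scalˡ c f g (suc n) =
      trans (cong (c * f 0 * g (suc n) +_) (⊛-scalˡ c (f ∘ suc) g n))
            (factor c (f 0) (g (suc n)) _)
      where
      factor : ∀ c a b x → c * a * b + c * x ≡ c * (a * b + x)
      factor = solve-∀

    ⊛-comm : ∀ f g n → (f ⊛ g) n ≡ (g ⊛ f) n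
    ⊛-comm f g zero = ℤ.*-comm (f 0) (g 0)
    ⊛-comm f g (suc zero) = swap (f 0) (f 1) (g 0) (g 1)
      where
      swap : ∀ a b c d → a * d + b * c ≡ c * b + d * a
      swap = solve-∀
    ⊛-comm f g (suc (suc n)) = begin
      f 0 * g (2 ℕ.+ n) + (f ∘ suc ⊛ g) (suc n)
        ≡⟨ cong (f 0 * g (2 ℕ.+ n) +_) (⊛-comm (f ∘ suc) g (suc n)) ⟩
      f 0 * g (2 ℕ.+ n) + (g 0 * f (2 ℕ.+ n) + (g ∘ suc ⊛ f ∘ suc) n)
        ≡⟨ cong (λ z → f 0 * g (2 ℕ.+ n) + (g 0 * f (2 ℕ.+ n) + z)) (⊛-comm (g ∘ suc) (f ∘ suc) n) ⟩
      f 0 * g (2 ℕ.+ n) + (g 0 * f (2 ℕ.+ n) + (f ∘ suc ⊛ g ∘ suc) n)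
        ≡⟨ swap (f 0 * g (2 ℕ.+ n)) (g 0 * f (2 ℕ.+ n)) _ ⟩
      g 0 * f (2 ℕ.+ n) + (f ⊛ g ∘ suc) (suc n)
        ≡⟨ cong (g 0 * f (2 ℕ.+ n) +_) (⊛-comm f (g ∘ suc) (suc n)) ⟩
      g 0 * f (2 ℕ.+ n) + (g ∘ suc ⊛ f) (suc n) ∎
      where
      open ≡-Reasoning
      swap : ∀ a b x → a + (b + x) ≡ b + (a + x)
      swap = solve-∀

    -- (f ⊛ g) ∘ suc is f 0 ⊙ g ∘ suc ⊕ f ∘ suc ⊛ g by definition.
    ⊛-assoc : ∀ f g h n → ((f ⊛ g) ⊛ h) n ≡ (f ⊛ (g ⊛ h)) n
    ⊛-assoc f g h zero = ℤ.*-assoc (f 0) (g 0) (h 0)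
    ⊛-assoc f g h (suc n) = begin
      f 0 * g 0 * h (suc n) + ((f 0 ⊙ g ∘ suc ⊕ f ∘ suc ⊛ g) ⊛ h) n
        ≡⟨ cong (f 0 * g 0 * h (suc n) +_) (⊛-distribʳ (f 0 ⊙ g ∘ suc) (f ∘ suc ⊛ g) h n) ⟩
      f 0 * g 0 * h (suc n) + ((f 0 ⊙ g ∘ suc ⊛ h) n + ((f ∘ suc ⊛ g) ⊛ h) n)
        ≡⟨ cong₂ (λ a b → f 0 * g 0 * h (suc n) + (a + b))
                 (⊛-scalˡ (f 0) (g ∘ suc) h n) (⊛-assoc (f ∘ suc) g h n) ⟩
      f 0 * g 0 * h (suc n) + (f 0 * (g ∘ suc ⊛ h) n + (f ∘ suc ⊛ (g ⊛ h)) n)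
        ≡⟨ factor (f 0) (g 0) (h (suc n)) _ _ ⟩
      f 0 * (g 0 * h (suc n) + (g ∘ suc ⊛ h) n) + (f ∘ suc ⊛ (g ⊛ h)) n ∎
      where
      open ≡-Reasoning
      factor : ∀ a b c x y → a * b * c + (a * x + y) ≡ a * (b * c + x) + y
      factor = solve-∀

  ≋-setoid : Setoid 0ℓ 0ℓ
  ≋-setoid = record
    { Carrier = Series
    ; _≈_ = _≋_
    ; isEquivalence = record { refl = ≋-refl ; sym = ≋-sym ; trans = ≋-trans }
    }

  module ≋-Reasoning = SetoidReasoning ≋-setoid

  ⊛-cong : ∀ {f f′ g g′} → f ≋ f′ → g ≋ g′ → f ⊛ g ≋ f′ ⊛ g′
  ⊛-cong p q = pointwise λ n → ⊛-coeff-cong n (λ {i} _ → coeff p i) (λ {i} _ → coeff q i)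

  SeriesRing : CommutativeRing 0ℓ 0ℓ
  SeriesRing = record
    { Carrier = Series
    ; _≈_ = _≋_
    ; _+_ = _⊕_
    ; _*_ = _⊛_
    ; -_ = ⊝_
    ; 0# = 0ₛ
    ; 1# = 1ₛ
    ; isCommutativeRing = record
      { isRing = record
        { +-isAbelianGroup = record
          { isGroup = record
            { isMonoid = record
              { isSemigroup = record
                { isMagma = record
                  { isEquivalence = Setoid.isEquivalence ≋-setoid
                  ; ∙-cong = λ p q → pointwise λ n → cong₂ _+_ (coeff p n) (coeff q n)
                  }
                ; assoc = λ f g h → pointwise λ n → ℤ.+-assoc (f n) (g n) (h n)
                }
              ; identity = (λ f → pointwise λ n → ℤ.+-identityˡ (f n))
                         , (λ f → pointwise λ n → ℤ.+-identityʳ (f n))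
              }
            ; inverse = (λ f → pointwise λ n → ℤ.+-inverseˡ (f n))
                      , (λ f → pointwise λ n → ℤ.+-inverseʳ (f n))
            ; ⁻¹-cong = λ p → pointwise λ n → cong -_ (coeff p n)
            }
          ; comm = λ f g → pointwise λ n → ℤ.+-comm (f n) (g n)
          }
        ; *-cong = ⊛-cong
        ; *-assoc = λ f g h → pointwise (⊛-assoc f g h)
        ; *-identity = comm∧idˡ⇒id ≋-setoid ⊛-comm′ (λ g → pointwise (⊛-identityˡ g))
        ; distrib = comm∧distrˡ⇒distr ≋-setoid
                      (λ p q → pointwise λ n → cong₂ _+_ (coeff p n) (coeff q n)) ⊛-comm′
                      (λ f g h → ≋-trans (⊛-comm′ f (g ⊕ h))
                                   (≋-trans (pointwise (⊛-distribʳ g h f))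
                                     (pointwise λ n → cong₂ _+_ (⊛-comm g f n) (⊛-comm h f n))))
        }
      ; *-comm = ⊛-comm′
      }
    }
    where
    ⊛-comm′ : ∀ f g → f ⊛ g ≋ g ⊛ f
    ⊛-comm′ f g = pointwise (⊛-comm f g)

  κ-⊛ : ∀ a b → κ (a * b) ≋ κ a ⊛ κ b
  κ-⊛ a b = pointwise λ where
    zero → refl
    (suc n) → sym (cong₂ _+_ (ℤ.*-zeroʳ a) (⊛-zeroˡ (κ b) n))

  module SeriesSolver where
    private
      κ-homomorphism : ACR._-Raw-AlmostCommutative⟶_
                         (CommutativeRing.rawRing ℤ.+-*-commutativeRing)
                         (ACR.fromCommutativeRing SeriesRing)
      κ-homomorphism = record
        { ⟦_⟧ = κ
        ; +-homo = λ a b → pointwise λ { zero → refl ; (suc n) → refl }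
        ; *-homo = κ-⊛
        ; -‿homo = λ a → pointwise λ { zero → refl ; (suc n) → refl }
        ; 0-homo = pointwise λ { zero → refl ; (suc n) → refl }
        ; 1-homo = pointwise λ { zero → refl ; (suc n) → refl }
        }

      κ-≟ : ∀ a b → Maybe (κ a ≋ κ b)
      κ-≟ a b with a ℤ.≟ b
      ... | yes refl = just ≋-refl
      ... | no _ = nothing

    open Algebra.Solver.Ring _ _ κ-homomorphism κ-≟ public

module Truncation where

  open PowerSeries
  open import Data.Integer as ℤ using (ℤ; _+_; _*_; -_; 1ℤ)
  open import Data.Nat as ℕ using (ℕ; zero; suc; _<_; _≤_; s≤s)
  open import Data.Sum using ([_,_])
  open import Level using (0ℓ)
  open import Relation.Binary.Bundles using (Setoid)

  open import Algebra.Properties.AbelianGroup ℤ.+-0-abelianGroup using (∙-cancelʳ)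

  infix 4 _≈[_]_
  record _≈[_]_ (f : Series) (T : ℕ) (g : Series) : Set where
    constructor below
    field coeff< : ∀ {i} → i < T → f i ≡ g i
  open _≈[_]_ public

  ≈[]-refl : ∀ {f T} → f ≈[ T ] f
  ≈[]-refl = below λ _ → refl

  ≈[]-sym : ∀ {f g T} → f ≈[ T ] g → g ≈[ T ] f
  ≈[]-sym p = below λ i<T → sym (coeff< p i<T)

  ≈[]-trans : ∀ {f g h T} → f ≈[ T ] g → g ≈[ T ] h → f ≈[ T ] h
  ≈[]-trans p q = below λ i<T → trans (coeff< p i<T) (coeff< q i<T)

  ≈[]-setoid : ℕ → Setoid 0ℓ 0ℓ
  ≈[]-setoid T = record
    { Carrier = Series
    ; _≈_ = _≈[ T ]_
    ; isEquivalence = record { refl = ≈[]-refl ; sym = ≈[]-sym ; trans = ≈[]-trans }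
    }

  ≋⇒≈[] : ∀ {f g} T → f ≋ g → f ≈[ T ] g
  ≋⇒≈[] T p = below λ {i} _ → coeff p i

  ≈[]-weaken : ∀ {f g T T′} → T′ ≤ T → f ≈[ T ] g → f ≈[ T′ ] g
  ≈[]-weaken T′≤T p = below λ i<T′ → coeff< p (ℕ.<-≤-trans i<T′ T′≤T)

  ≈[]-⊕ : ∀ {f f′ g g′ T} → f ≈[ T ] f′ → g ≈[ T ] g′ → f ⊕ g ≈[ T ] f′ ⊕ g′
  ≈[]-⊕ p q = below λ i<T → cong₂ _+_ (coeff< p i<T) (coeff< q i<T)

  ≈[]-⊛ : ∀ {f f′ g g′ T} → f ≈[ T ] f′ → g ≈[ T ] g′ → f ⊛ g ≈[ T ] f′ ⊛ g′
  ≈[]-⊛ p q = below λ {i} i<T →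
    ⊛-coeff-cong i (λ j≤i → coeff< p (ℕ.≤-<-trans j≤i i<T)) (λ j≤i → coeff< q (ℕ.≤-<-trans j≤i i<T))

  ≈[]-extend : ∀ {f g i} → f ≈[ i ] g → f i ≡ g i → f ≈[ suc i ] g
  ≈[]-extend {i = i} p fi≡gi =
    below λ j<1+i → [ coeff< p , (λ { refl → fi≡gi }) ] (ℕ.m<1+n⇒m<n∨m≡n j<1+i)

  -- Coefficient i of φ ⊛ A is φ 0 * A i plus a term involving only A 0, …, A (i - 1).
  ⊛-leading : ∀ φ {A B} i → A ≈[ i ] B → (φ ⊛ A) i ≡ (φ ⊛ B) i → φ 0 * A i ≡ φ 0 * B i
  ⊛-leading φ zero _ eq = eq
  ⊛-leading φ {A} {B} (suc i) A≈B eq =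
    ∙-cancelʳ ((φ ∘ suc ⊛ B) i) _ _
      (trans (cong (φ 0 * A (suc i) +_) (sym (⊛-coeff-cong i (λ _ → refl) (coeff< A≈B ∘ s≤s)))) eq)

  ⊛-cancelˡ : ∀ {φ A B T} → φ 0 ≡ 1ℤ → φ ⊛ A ≈[ T ] φ ⊛ B → A ≈[ T ] B
  ⊛-cancelˡ {φ} {A} {B} {T} φ0≡1 φA≈φB = agreeBelow T ℕ.≤-refl
    where
    unit : ∀ a → φ 0 * a ≡ a
    unit a = trans (cong (_* a) φ0≡1) (ℤ.*-identityˡ a)

    agreeBelow : ∀ i → i ≤ T → A ≈[ i ] B
    agreeBelow zero _ = below λ ()
    agreeBelow (suc i) i<T = ≈[]-extend A≈B
      (trans (sym (unit (A i))) (trans (⊛-leading φ i A≈B (coeff< φA≈φB i<T)) (unit (B i))))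
      where
      A≈B : A ≈[ i ] B
      A≈B = agreeBelow i (ℕ.<⇒≤ i<T)

module Monomials where

  open PowerSeries
  open Truncation
  open import Data.Integer as ℤ using (ℤ; _+_; _*_; -_; 0ℤ; 1ℤ; -1ℤ)
  open import Data.Nat as ℕ using (ℕ; zero; suc; _<_; s≤s)
  open import Data.Product using (_,_)
  open import Relation.Binary.Definitions using (tri<; tri≈; tri>)
  open import Relation.Nullary using (contradiction)

  open CommutativeRing SeriesRing using (*-identityˡ; *-identityʳ; *-assoc; *-cong; zeroˡ; commutativeSemiring)
  open import Algebra.Properties.CommutativeSemiring.Exp commutativeSemiring public
    using (_^_; ^-homo-*; ^-assocʳ; ^-congˡ)

  shift : ℕ → Series → Series
  shift zero f = f
  shift (suc k) f zero = 0ℤ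
  shift (suc k) f (suc n) = shift k f n

  shift-coeff-+ : ∀ k f n → shift k f (k ℕ.+ n) ≡ f n
  shift-coeff-+ zero f n = refl
  shift-coeff-+ (suc k) f n = shift-coeff-+ k f n

  shift-coeff-self : ∀ k f → shift k f k ≡ f 0
  shift-coeff-self zero f = refl
  shift-coeff-self (suc k) f = shift-coeff-self k f

  shift-coeff-< : ∀ {k n} f → n < k → shift k f n ≡ 0ℤ
  shift-coeff-< {suc k} {zero} f _ = refl
  shift-coeff-< {suc k} {suc n} f (s≤s n<k) = shift-coeff-< f n<k

  X : Series
  X = shift 1 1ₛ

  X-⊛ : ∀ f → X ⊛ f ≋ shift 1 f
  X-⊛ f = pointwise λ where
    zero → refl
    (suc n) → trans (ℤ.+-identityˡ _) (coeff (*-identityˡ f) n)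

  X^-⊛ : ∀ k f → X ^ k ⊛ f ≋ shift k f
  X^-⊛ zero f = *-identityˡ f
  X^-⊛ (suc k) f = begin
    X ⊛ X ^ k ⊛ f      ≈⟨ *-assoc X (X ^ k) f ⟩
    X ⊛ (X ^ k ⊛ f)    ≈⟨ *-cong ≋-refl (X^-⊛ k f) ⟩
    X ⊛ shift k f      ≈⟨ X-⊛ (shift k f) ⟩
    shift 1 (shift k f) ≈⟨ pointwise (λ { zero → refl ; (suc n) → refl }) ⟩
    shift (suc k) f    ∎
    where open ≋-Reasoning

  X^-coeff : ∀ k n → (X ^ k) n ≡ shift k 1ₛ n
  X^-coeff k n = trans (sym (coeff (*-identityʳ (X ^ k)) n)) (coeff (X^-⊛ k 1ₛ) n)

  X^-coeff-self : ∀ k → (X ^ k) k ≡ 1ℤ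
  X^-coeff-self k = begin
    (X ^ k) k            ≡⟨ cong (X ^ k) (sym (ℕ.+-identityʳ k)) ⟩
    (X ^ k) (k ℕ.+ 0)    ≡⟨ X^-coeff k (k ℕ.+ 0) ⟩
    shift k 1ₛ (k ℕ.+ 0) ≡⟨ shift-coeff-+ k 1ₛ 0 ⟩
    1ℤ                   ∎
    where open ≡-Reasoning

  X^-coeff-≢ : ∀ {k n} → k ≢ n → (X ^ k) n ≡ 0ℤ
  X^-coeff-≢ {k} {n} k≢n with ℕ.<-cmp n k
  ... | tri< n<k _ _ = trans (X^-coeff k n) (shift-coeff-< 1ₛ n<k)
  ... | tri≈ _ n≡k _ = contradiction (sym n≡k) k≢n
  ... | tri> _ _ k<n with ℕ.m≤n⇒∃[o]m+o≡n (ℕ.<⇒≤ k<n)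
  ...   | zero , k+0≡n = contradiction (trans (sym (ℕ.+-identityʳ k)) k+0≡n) k≢n
  ...   | suc o , refl = trans (X^-coeff k n) (shift-coeff-+ k 1ₛ (suc o))

  X^≈[]0 : ∀ k → X ^ k ≈[ k ] 0ₛ
  X^≈[]0 k = below λ {i} i<k → X^-coeff-≢ (ℕ.>⇒≢ i<k)

  X^⊛-≈[] : ∀ k {f g T} → f ≈[ T ] g → X ^ k ⊛ f ≈[ k ℕ.+ T ] X ^ k ⊛ g
  X^⊛-≈[] k {f} {g} f≈g = below λ {i} i<k+T → begin
    (X ^ k ⊛ f) i  ≡⟨ coeff (X^-⊛ k f) i ⟩
    shift k f i    ≡⟨ shifted k i i<k+T ⟩
    shift k g i    ≡⟨ coeff (X^-⊛ k g) i ⟨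
    (X ^ k ⊛ g) i  ∎
    where
    open ≡-Reasoning
    shifted : ∀ k i → i < k ℕ.+ _ → shift k f i ≡ shift k g i
    shifted zero i i<T = coeff< f≈g i<T
    shifted (suc k) zero _ = refl
    shifted (suc k) (suc i) (s≤s i<k+T) = shifted k i i<k+T

  X^⊛-cancel-≈[] : ∀ k {f g T} → X ^ k ⊛ f ≈[ k ℕ.+ T ] X ^ k ⊛ g → f ≈[ T ] g
  X^⊛-cancel-≈[] k {f} {g} Xf≈Xg = below λ {i} i<T → begin
    f i                    ≡⟨ shift-coeff-+ k f i ⟨
    shift k f (k ℕ.+ i)    ≡⟨ coeff (X^-⊛ k f) (k ℕ.+ i) ⟨
    (X ^ k ⊛ f) (k ℕ.+ i)  ≡⟨ coeff< Xf≈Xg (ℕ.+-monoʳ-< k i<T) ⟩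
    (X ^ k ⊛ g) (k ℕ.+ i)  ≡⟨ coeff (X^-⊛ k g) (k ℕ.+ i) ⟩
    shift k g (k ℕ.+ i)    ≡⟨ shift-coeff-+ k g i ⟩
    g i                    ∎
    where open ≡-Reasoning

  κ-⊛-coeff : ∀ c f n → (κ c ⊛ f) n ≡ c * f n
  κ-⊛-coeff c f zero = refl
  κ-⊛-coeff c f (suc n) = trans (cong (c * f (suc n) +_) (coeff (zeroˡ f) n)) (ℤ.+-identityʳ _)

  sign : ℕ → Series
  sign k = (⊝ 1ₛ) ^ k

  sign-+ : ∀ a b → sign (a ℕ.+ b) ≋ sign a ⊛ sign b
  sign-+ = ^-homo-* (⊝ 1ₛ)

  sign-⊛-sign : ∀ a → sign a ⊛ sign a ≋ 1ₛ
  sign-⊛-sign zero = *-identityˡ 1ₛ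
  sign-⊛-sign (suc a) = ≋-trans (square (sign a)) (sign-⊛-sign a)
    where
    open SeriesSolver
    square : ∀ s → (⊝ 1ₛ ⊛ s) ⊛ (⊝ 1ₛ ⊛ s) ≋ s ⊛ s
    square = solve 1 (λ s → (:- con 1ℤ :* s) :* (:- con 1ℤ :* s) := s :* s) ≋-refl

  sign-⊛-coeff : ∀ k f n → (sign k ⊛ f) n ≡ (-1ℤ ℤ.^ k) * f n
  sign-⊛-coeff zero f n = trans (coeff (*-identityˡ f) n) (sym (ℤ.*-identityˡ (f n)))
  sign-⊛-coeff (suc k) f n = begin
    (⊝ 1ₛ ⊛ sign k ⊛ f) n           ≡⟨ coeff (*-assoc (⊝ 1ₛ) (sign k) f) n ⟩
    (⊝ 1ₛ ⊛ (sign k ⊛ f)) n         ≡⟨ ⊛-coeff-cong n (λ {i} _ → minus-one i) (λ _ → refl) ⟩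
    (κ -1ℤ ⊛ (sign k ⊛ f)) n        ≡⟨ κ-⊛-coeff -1ℤ (sign k ⊛ f) n ⟩
    -1ℤ * (sign k ⊛ f) n            ≡⟨ cong (-1ℤ *_) (sign-⊛-coeff k f n) ⟩
    -1ℤ * ((-1ℤ ℤ.^ k) * f n)       ≡⟨ ℤ.*-assoc -1ℤ (-1ℤ ℤ.^ k) (f n) ⟨
    (-1ℤ ℤ.^ suc k) * f n           ∎
    where
    open ≡-Reasoning
    minus-one : ∀ i → (⊝ 1ₛ) i ≡ κ -1ℤ i
    minus-one zero = refl
    minus-one (suc i) = refl

  1-X^≈[]1 : ∀ n → 1ₛ ⊕ ⊝ X ^ n ≈[ n ] 1ₛ
  1-X^≈[]1 n = below λ {i} i<n →
    trans (cong (λ c → 1ₛ i + - c) (coeff< (X^≈[]0 n) i<n)) (ℤ.+-identityʳ (1ₛ i))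

  ≈[]-⊛-X^ : ∀ E h {f g T} → f ≈[ T ] g → f ⊛ (h ⊛ X ^ E) ≈[ E ℕ.+ T ] g ⊛ (h ⊛ X ^ E)
  ≈[]-⊛-X^ E h {f} {g} f≈g = begin
    f ⊛ (h ⊛ X ^ E)   ≈⟨ ≋⇒≈[] _ (swap f h (X ^ E)) ⟩
    X ^ E ⊛ (h ⊛ f)   ≈⟨ X^⊛-≈[] E (≈[]-⊛ ≈[]-refl f≈g) ⟩
    X ^ E ⊛ (h ⊛ g)   ≈⟨ ≋⇒≈[] _ (swap g h (X ^ E)) ⟨
    g ⊛ (h ⊛ X ^ E)   ∎
    where
    open SetoidReasoning (≈[]-setoid _)
    open SeriesSolver
    swap : ∀ f h x → f ⊛ (h ⊛ x) ≋ x ⊛ (h ⊛ f)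
    swap = solve 3 (λ f h x → f :* (h :* x) := x :* (h :* f)) ≋-refl

module FiniteSums where

  open PowerSeries
  open Truncation
  open RangeSum
  open import Data.Integer as ℤ using (ℤ; _+_; -_; +_; 0ℤ)
  open import Data.Nat as ℕ using (ℕ; zero; suc; _∸_; _<_; z≤n; s≤s)
  open import Data.Bool using (if_then_else_; true; false)
  open import Data.List using (_∷_; filter; map; applyUpTo)
  open import Data.Nat.ListAction using () renaming (sum to sumℕ)
  import Data.Integer.Tactic.RingSolver as ℤ-Solver
  open import Relation.Nullary using (does)
  open import Relation.Unary using (Pred; Decidable)

  open CommutativeRing SeriesRing
    using (+-commutativeMonoid; *-commutativeMonoid; semiring; +-identityˡ; +-identityʳ; +-cong; reflexive)

  open Sum ℤ.+-0-commutativeMonoid public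
  open Sum +-commutativeMonoid public
    using () renaming (∑ to ∑ₛ; ∑-cong to ∑ₛ-cong; ∑-distrib to ∑ₛ-distrib; ∑-last to ∑ₛ-last;
                       ∑-split to ∑ₛ-split; ∑-reverse to ∑ₛ-reverse)
  open Sum *-commutativeMonoid public
    using () renaming (∑ to ∏; ∑-cong to ∏-cong; ∑-distrib to ∏-distrib; ∑-last to ∏-last;
                       ∑-split to ∏-split; ∑-reverse to ∏-reverse; ∑-const to ∏-const)
  open SumDistrib semiring public
    using () renaming (∑-distribʳ to ∑ₛ-⊛-distribʳ; ∑-distribˡ to ∑ₛ-⊛-distribˡ)

  ∑ₛ-coeff : ∀ n F i → ∑ₛ n F i ≡ ∑ n (λ k → F k i)
  ∑ₛ-coeff zero F i = refl
  ∑ₛ-coeff (suc n) F i = cong (_+_ (F 0 i)) (∑ₛ-coeff n (F ∘ suc) i)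

  ∑ₛ-cong-≈[] : ∀ n {f g T} → (∀ {k} → k < n → f k ≈[ T ] g k) → ∑ₛ n f ≈[ T ] ∑ₛ n g
  ∑ₛ-cong-≈[] zero f≈g = ≈[]-refl
  ∑ₛ-cong-≈[] (suc n) f≈g = ≈[]-⊕ (f≈g (s≤s z≤n)) (∑ₛ-cong-≈[] n (f≈g ∘ s≤s))

  antidiagonal : ℕ → (ℕ → ℕ → Series) → Series
  antidiagonal N F = ∑ₛ (suc N) (λ a → F a (N ∸ a))

  antidiagonal-cong : ∀ N {F G} → (∀ a b → a ℕ.+ b ≡ N → F a b ≋ G a b) →
                      antidiagonal N F ≋ antidiagonal N G
  antidiagonal-cong N F≋G = ∑ₛ-cong (suc N) λ {a} a<1+N → F≋G a (N ∸ a) (ℕ.m+[n∸m]≡n (ℕ.≤-pred a<1+N))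

  shiftFst shiftSnd : (ℕ → ℕ → Series) → ℕ → ℕ → Series
  shiftFst F zero b = 0ₛ
  shiftFst F (suc a) b = F a b
  shiftSnd F a zero = 0ₛ
  shiftSnd F a (suc b) = F a b

  antidiagonal-shiftFst : ∀ N F → antidiagonal (suc N) (shiftFst F) ≋ antidiagonal N F
  antidiagonal-shiftFst N F = +-identityˡ (antidiagonal N F)

  antidiagonal-shiftSnd : ∀ N F → antidiagonal (suc N) (shiftSnd F) ≋ antidiagonal N F
  antidiagonal-shiftSnd N F = begin
    antidiagonal (suc N) (shiftSnd F)
      ≈⟨ ∑ₛ-last (suc N) (λ a → shiftSnd F a (suc N ∸ a)) ⟩
    ∑ₛ (suc N) (λ a → shiftSnd F a (suc N ∸ a)) ⊕ shiftSnd F (suc N) (N ∸ N)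
      ≈⟨ +-cong (∑ₛ-cong (suc N) shifted) (reflexive (cong (shiftSnd F (suc N)) (ℕ.n∸n≡0 N))) ⟩
    antidiagonal N F ⊕ 0ₛ
      ≈⟨ +-identityʳ (antidiagonal N F) ⟩
    antidiagonal N F ∎
    where
    open ≋-Reasoning
    shifted : ∀ {a} → a < suc N → shiftSnd F a (suc N ∸ a) ≋ F a (N ∸ a)
    shifted {a} a≤N = reflexive (cong (shiftSnd F a) (ℕ.+-∸-assoc 1 (ℕ.≤-pred a≤N)))

  antidiagonal-suc : ∀ N F G →
    antidiagonal (suc N) (λ a b → shiftSnd F a b ⊕ shiftFst G a b) ≋ antidiagonal N F ⊕ antidiagonal N G
  antidiagonal-suc N F G =
    ≋-trans (∑ₛ-distrib (suc (suc N)) (λ a → shiftSnd F a (suc N ∸ a)) (λ a → shiftFst G a (suc N ∸ a)))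
            (+-cong (antidiagonal-shiftSnd N F) (antidiagonal-shiftFst N G))

  ⊛-coeff-∑ : ∀ f g n → (f ⊛ g) n ≡ ∑ (suc n) (λ k → f k ℤ.* g (n ∸ k))
  ⊛-coeff-∑ f g zero = sym (ℤ.+-identityʳ _)
  ⊛-coeff-∑ f g (suc n) = cong (_+_ (f 0 ℤ.* g (suc n))) (⊛-coeff-∑ (f ∘ suc) g n)

  ∑-neg : ∀ n f → ∑ n (λ k → - f k) ≡ - ∑ n f
  ∑-neg zero f = refl
  ∑-neg (suc n) f = trans (cong (_+_ (- f 0)) (∑-neg n (f ∘ suc))) (sym (ℤ.neg-distrib-+ (f 0) (∑ n (f ∘ suc))))

  ∑-three : ∀ r (W : ℕ → ℤ) → (∀ {j} → j < r → W (suc j) ≡ 0ℤ) →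
            ∑ (3 ℕ.+ r) W ≡ W 0 + W (suc r) + W (suc (suc r))
  ∑-three r W middle = begin
    W 0 + ∑ (2 ℕ.+ r) (W ∘ suc)
      ≡⟨ cong (λ n → W 0 + ∑ n (W ∘ suc)) (ℕ.+-comm 2 r) ⟩
    W 0 + ∑ (r ℕ.+ 2) (W ∘ suc)
      ≡⟨ cong (_+_ (W 0)) (∑-split r 2 (W ∘ suc)) ⟩
    W 0 + (∑ r (W ∘ suc) + (W (suc (r ℕ.+ 0)) + (W (suc (r ℕ.+ 1)) + 0ℤ)))
      ≡⟨ cong₂ (λ a b → W 0 + (a + b)) (∑-ε r middle)
               (cong₂ (λ a b → W (suc a) + (W (suc b) + 0ℤ)) (ℕ.+-identityʳ r) (ℕ.+-comm r 1)) ⟩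
    W 0 + (0ℤ + (W (suc r) + (W (suc (suc r)) + 0ℤ)))
      ≡⟨ regroup (W 0) (W (suc r)) (W (suc (suc r))) ⟩
    W 0 + W (suc r) + W (suc (suc r)) ∎
    where
    open ≡-Reasoning
    regroup : ∀ a b c → a + (0ℤ + (b + (c + 0ℤ))) ≡ a + b + c
    regroup = ℤ-Solver.solve-∀

  map-applyUpTo : ∀ {A B : Set} (f : A → B) (h : ℕ → A) n → map f (applyUpTo h n) ≡ applyUpTo (f ∘ h) n
  map-applyUpTo f h zero = refl
  map-applyUpTo f h (suc n) = cong (f (h 0) ∷_) (map-applyUpTo f (h ∘ suc) n)

  sum-filter : ∀ {p} {P : Pred ℕ p} (P? : Decidable P) n f →
               + sumℕ (filter P? (applyUpTo f n)) ≡ ∑ n (λ k → if does (P? (f k)) then + f k else 0ℤ)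
  sum-filter P? zero f = refl
  sum-filter P? (suc n) f with does (P? (f 0))
  ... | true = trans (ℤ.pos-+ (f 0) _) (cong (_+_ (+ f 0)) (sum-filter P? n (f ∘ suc)))
  ... | false = trans (sum-filter P? n (f ∘ suc)) (sym (ℤ.+-identityˡ _))

module LogarithmicDerivative where

  open PowerSeries
  open Truncation
  open Monomials
  open FiniteSums using (∏; ∑ₛ)
  open import Data.Bool using (if_then_else_)
  open import Data.Integer as ℤ using (ℤ; +_; _+_; _*_; -_; 0ℤ; 1ℤ)
  open import Data.Integer.Tactic.RingSolver using (solve-∀)
  open import Data.Nat as ℕ using (ℕ; zero; suc; _<_; _≤_)
  open import Data.Nat.Divisibility using (_∣_; _∣?_; ∣-refl; ∣⇒≤; ∣m∣n⇒∣m+n; ∣m+n∣m⇒∣n)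
  open import Data.Product using (_,_)
  open import Relation.Binary.Definitions using (tri<; tri≈; tri>)
  open import Relation.Nullary using (¬_; Dec; does; yes; no)
  open import Relation.Nullary.Decidable using (dec-true; dec-false)

  open CommutativeRing SeriesRing using (+-cong; +-congˡ; +-identityˡ; -‿cong; *-congˡ; *-congʳ; distribʳ; zeroˡ)

  xD : Series → Series
  xD f n = + n * f n

  xD-⊕ : ∀ f g → xD (f ⊕ g) ≋ xD f ⊕ xD g
  xD-⊕ f g = pointwise λ n → ℤ.*-distribˡ-+ (+ n) (f n) (g n)

  xD-⊝ : ∀ f → xD (⊝ f) ≋ ⊝ xD f
  xD-⊝ f = pointwise λ n → sym (ℤ.neg-distribʳ-* (+ n) (f n))

  xD-1 : xD 1ₛ ≋ 0ₛ
  xD-1 = pointwise λ where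
    zero → refl
    (suc n) → ℤ.*-zeroʳ (+ suc n)

  xD-X^ : ∀ d → xD (X ^ d) ≋ κ (+ d) ⊛ X ^ d
  xD-X^ d = pointwise λ n → trans (scale n) (sym (κ-⊛-coeff (+ d) (X ^ d) n))
    where
    scale : ∀ n → + n * (X ^ d) n ≡ + d * (X ^ d) n
    scale n with d ℕ.≟ n
    ... | yes refl = refl
    ... | no d≢n = trans (cong (+ n *_) (X^-coeff-≢ d≢n))
                     (trans (ℤ.*-zeroʳ (+ n)) (sym (trans (cong (+ d *_) (X^-coeff-≢ d≢n)) (ℤ.*-zeroʳ (+ d)))))

  xD-⊛ : ∀ f g → xD (f ⊛ g) ≋ xD f ⊛ g ⊕ f ⊛ xD g
  xD-⊛ f g = pointwise (leibniz f)
    where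
    xD-suc : ∀ f i → xD f (suc i) ≡ (xD (f ∘ suc) ⊕ f ∘ suc) i
    xD-suc f i = trans (cong (_* f (suc i)) (ℤ.pos-+ 1 i)) (expand (+ i) (f (suc i)))
      where
      expand : ∀ i a → (+ 1 + i) * a ≡ i * a + a
      expand = solve-∀

    leibniz : ∀ f n → xD (f ⊛ g) n ≡ (xD f ⊛ g ⊕ f ⊛ xD g) n
    leibniz f zero = vanish (f 0) (g 0)
      where
      vanish : ∀ a b → + 0 * (a * b) ≡ + 0 * a * b + a * (+ 0 * b)
      vanish = solve-∀
    leibniz f (suc n) = begin
      + suc n * (f 0 * g (suc n) + P)
        ≡⟨ cong (_* (f 0 * g (suc n) + P)) (ℤ.pos-+ 1 n) ⟩
      (+ 1 + + n) * (f 0 * g (suc n) + P)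
        ≡⟨ expand (+ n) (f 0) (g (suc n)) P ⟩
      (+ n * P + P) + f 0 * xD g (suc n)
        ≡⟨ cong (λ z → (z + P) + f 0 * xD g (suc n)) (leibniz (f ∘ suc) n) ⟩
      (A + B + P) + f 0 * xD g (suc n)
        ≡⟨ rearrange A B P (f 0 * xD g (suc n)) (f 0) (g (suc n)) ⟩
      (xD f 0 * g (suc n) + (A + P)) + (f 0 * xD g (suc n) + B)
        ≡⟨ cong (λ z → (xD f 0 * g (suc n) + z) + (f 0 * xD g (suc n) + B)) tail ⟩
      (xD f ⊛ g ⊕ f ⊛ xD g) (suc n) ∎
      where
      open ≡-Reasoning
      P A B : ℤ
      P = (f ∘ suc ⊛ g) n
      A = (xD (f ∘ suc) ⊛ g) n
      B = (f ∘ suc ⊛ xD g) n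
      tail : A + P ≡ (xD f ∘ suc ⊛ g) n
      tail = sym (trans (⊛-coeff-cong n (λ {i} _ → xD-suc f i) (λ _ → refl))
                        (coeff (distribʳ g (xD (f ∘ suc)) (f ∘ suc)) n))
      expand : ∀ n a b p → (+ 1 + n) * (a * b + p) ≡ (n * p + p) + a * ((+ 1 + n) * b)
      expand = solve-∀
      rearrange : ∀ a b p c x y → (a + b + p) + c ≡ (+ 0 * x * y + (a + p)) + (c + b)
      rearrange = solve-∀

  xD-≈[] : ∀ {f g T} → f ≈[ T ] g → xD f ≈[ T ] xD g
  xD-≈[] {T = T} f≈g = below λ {i} i<T → cong (+ i *_) (coeff< f≈g i<T)

  -- H d = d X^d / (1 - X^d) = Σ_{j ≥ 1} d X^{dj}
  H : ℕ → Series
  H d zero = 0ℤ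
  H d (suc n) = if does (d ∣? suc n) then + d else 0ℤ

  H-coeff-∣ : ∀ {d n} → d ∣ suc n → H d (suc n) ≡ + d
  H-coeff-∣ {d} {n} d∣1+n = cong (if_then + d else 0ℤ) (dec-true (d ∣? suc n) d∣1+n)

  H-coeff-∤ : ∀ {d n} → ¬ d ∣ suc n → H d (suc n) ≡ 0ℤ
  H-coeff-∤ {d} {n} d∤1+n = cong (if_then + d else 0ℤ) (dec-false (d ∣? suc n) d∤1+n)

  H-coeff-< : ∀ {d n} → n < d → H d n ≡ 0ℤ
  H-coeff-< {n = zero} _ = refl
  H-coeff-< {n = suc n} n<d = H-coeff-∤ (λ d∣n → ℕ.<⇒≱ n<d (∣⇒≤ d∣n))

  H-periodic : ∀ d n → H d (suc (d ℕ.+ n)) ≡ H d (suc n)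
  H-periodic d n = byCases (d ∣? suc n)
    where
    cancel : d ∣ suc (d ℕ.+ n) → d ∣ suc n
    cancel d∣d+1+n = ∣m+n∣m⇒∣n (subst (d ∣_) (sym (ℕ.+-suc d n)) d∣d+1+n) ∣-refl
    byCases : Dec (d ∣ suc n) → H d (suc (d ℕ.+ n)) ≡ H d (suc n)
    byCases (yes d∣1+n) =
      trans (H-coeff-∣ (subst (d ∣_) (ℕ.+-suc d n) (∣m∣n⇒∣m+n ∣-refl d∣1+n))) (sym (H-coeff-∣ d∣1+n))
    byCases (no d∤1+n) = trans (H-coeff-∤ (d∤1+n ∘ cancel)) (sym (H-coeff-∤ d∤1+n))

  module _ where
    open ≡-Reasoning

    H-shift-coeff : ∀ d → 1 ≤ d → ∀ n → H d n + - shift d (H d) n ≡ + d * (X ^ d) n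
    H-shift-coeff d@(suc _) _ n with ℕ.<-cmp n d
    ... | tri< n<d _ _ = begin
      H d n + - shift d (H d) n  ≡⟨ cong₂ (λ a b → a + - b) (H-coeff-< n<d) (shift-coeff-< (H d) n<d) ⟩
      0ℤ                         ≡⟨ ℤ.*-zeroʳ (+ d) ⟨
      + d * 0ℤ                   ≡⟨ cong (+ d *_) (X^-coeff-≢ (ℕ.>⇒≢ n<d)) ⟨
      + d * (X ^ d) n            ∎
    ... | tri≈ _ refl _ = begin
      H d d + - shift d (H d) d  ≡⟨ cong₂ (λ a b → a + - b) (H-coeff-∣ ∣-refl) (shift-coeff-self d (H d)) ⟩
      + d + 0ℤ                   ≡⟨ ℤ.+-identityʳ (+ d) ⟩
      + d                        ≡⟨ ℤ.*-identityʳ (+ d) ⟨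
      + d * 1ℤ                   ≡⟨ cong (+ d *_) (X^-coeff-self d) ⟨
      + d * (X ^ d) d            ∎
    ... | tri> _ _ d<n with ℕ.m≤n⇒∃[o]m+o≡n d<n
    ...   | o , refl = begin
      H d (suc (d ℕ.+ o)) + - shift d (H d) (suc (d ℕ.+ o))
        ≡⟨ cong₂ (λ a b → a + - b) (H-periodic d o)
                 (trans (cong (shift d (H d)) (sym (ℕ.+-suc d o))) (shift-coeff-+ d (H d) (suc o))) ⟩
      H d (suc o) + - H d (suc o)
        ≡⟨ ℤ.+-inverseʳ (H d (suc o)) ⟩
      0ℤ
        ≡⟨ ℤ.*-zeroʳ (+ d) ⟨
      + d * 0ℤ
        ≡⟨ cong (+ d *_) (X^-coeff-≢ (ℕ.<⇒≢ d<n)) ⟨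
      + d * (X ^ d) (suc (d ℕ.+ o)) ∎

  1-X^-⊛-H : ∀ d → 1 ≤ d → (1ₛ ⊕ ⊝ X ^ d) ⊛ H d ≋ κ (+ d) ⊛ X ^ d
  1-X^-⊛-H d 1≤d = begin
    (1ₛ ⊕ ⊝ X ^ d) ⊛ H d     ≈⟨ expand (X ^ d) (H d) ⟩
    H d ⊕ ⊝ (X ^ d ⊛ H d)    ≈⟨ +-congˡ {H d} (-‿cong (X^-⊛ d (H d))) ⟩
    H d ⊕ ⊝ shift d (H d)    ≈⟨ pointwise coefficient ⟩
    κ (+ d) ⊛ X ^ d          ∎
    where
    open ≋-Reasoning
    open SeriesSolver
    coefficient : ∀ n → (H d ⊕ ⊝ shift d (H d)) n ≡ (κ (+ d) ⊛ X ^ d) n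
    coefficient n = trans (H-shift-coeff d 1≤d n) (sym (κ-⊛-coeff (+ d) (X ^ d) n))
    expand : ∀ x h → (1ₛ ⊕ ⊝ x) ⊛ h ≋ h ⊕ ⊝ (x ⊛ h)
    expand = solve 2 (λ x h → (con 1ℤ :+ :- x) :* h := h :+ :- (x :* h)) ≋-refl

  HasLogDerivative : Series → Series → Set
  HasLogDerivative F L = xD F ≋ L ⊛ F

  hasLogDerivative-1 : HasLogDerivative 1ₛ 0ₛ
  hasLogDerivative-1 = ≋-trans xD-1 (≋-sym (zeroˡ 1ₛ))

  hasLogDerivative-⊛ : ∀ {F G L K} → HasLogDerivative F L → HasLogDerivative G K →
                       HasLogDerivative (F ⊛ G) (L ⊕ K)
  hasLogDerivative-⊛ {F} {G} {L} {K} F′ G′ = begin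
    xD (F ⊛ G)                  ≈⟨ xD-⊛ F G ⟩
    xD F ⊛ G ⊕ F ⊛ xD G         ≈⟨ +-cong (*-congʳ F′) (*-congˡ G′) ⟩
    (L ⊛ F) ⊛ G ⊕ F ⊛ (K ⊛ G)   ≈⟨ collect L K F G ⟩
    (L ⊕ K) ⊛ (F ⊛ G)           ∎
    where
    open ≋-Reasoning
    open SeriesSolver
    collect : ∀ L K F G → (L ⊛ F) ⊛ G ⊕ F ⊛ (K ⊛ G) ≋ (L ⊕ K) ⊛ (F ⊛ G)
    collect = solve 4 (λ L K F G → (L :* F) :* G :+ F :* (K :* G) := (L :+ K) :* (F :* G)) ≋-refl

  hasLogDerivative-1-X^ : ∀ d → 1 ≤ d → HasLogDerivative (1ₛ ⊕ ⊝ X ^ d) (⊝ H d)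
  hasLogDerivative-1-X^ d 1≤d = begin
    xD (1ₛ ⊕ ⊝ X ^ d)            ≈⟨ xD-⊕ 1ₛ (⊝ X ^ d) ⟩
    xD 1ₛ ⊕ xD (⊝ X ^ d)         ≈⟨ +-cong xD-1 (≋-trans (xD-⊝ (X ^ d)) (-‿cong (xD-X^ d))) ⟩
    0ₛ ⊕ ⊝ (κ (+ d) ⊛ X ^ d)     ≈⟨ +-identityˡ _ ⟩
    ⊝ (κ (+ d) ⊛ X ^ d)          ≈⟨ -‿cong (≋-sym (1-X^-⊛-H d 1≤d)) ⟩
    ⊝ ((1ₛ ⊕ ⊝ X ^ d) ⊛ H d)     ≈⟨ reorder (X ^ d) (H d) ⟩
    ⊝ H d ⊛ (1ₛ ⊕ ⊝ X ^ d)       ∎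
    where
    open ≋-Reasoning
    open SeriesSolver
    reorder : ∀ x h → ⊝ ((1ₛ ⊕ ⊝ x) ⊛ h) ≋ ⊝ h ⊛ (1ₛ ⊕ ⊝ x)
    reorder = solve 2 (λ x h → :- ((con 1ℤ :+ :- x) :* h) := :- h :* (con 1ℤ :+ :- x)) ≋-refl

  hasLogDerivative-∏ : ∀ n {F L} → (∀ k → HasLogDerivative (F k) (L k)) → HasLogDerivative (∏ n F) (∑ₛ n L)
  hasLogDerivative-∏ zero F′ = hasLogDerivative-1
  hasLogDerivative-∏ (suc n) F′ = hasLogDerivative-⊛ (F′ 0) (hasLogDerivative-∏ n (F′ ∘ suc))

module Choose2 where

  open import Data.Nat using (ℕ; zero; suc; _+_; _*_)
  open import Data.Nat.Combinatorics using (_C_; nC1≡n; nCk+nC[k+1]≡[n+1]C[k+1])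
  open import Data.Nat.Tactic.RingSolver using (solve-∀)

  C2-suc : ∀ a → suc a C 2 ≡ a C 2 + a
  C2-suc a = trans (sym (nCk+nC[k+1]≡[n+1]C[k+1] a 1)) (trans (cong (_+ a C 2) (nC1≡n a)) (ℕ.+-comm a (a C 2)))

  C2-+ : ∀ a b → (a + b) C 2 ≡ a C 2 + b C 2 + a * b
  C2-+ zero b = sym (ℕ.+-identityʳ (b C 2))
  C2-+ (suc a) b = begin
    suc (a + b) C 2                       ≡⟨ C2-suc (a + b) ⟩
    (a + b) C 2 + (a + b)                 ≡⟨ cong (_+ (a + b)) (C2-+ a b) ⟩
    a C 2 + b C 2 + a * b + (a + b)       ≡⟨ regroup (a C 2) (b C 2) a b ⟩
    (a C 2 + a) + b C 2 + suc a * b       ≡⟨ cong (λ t → t + b C 2 + suc a * b) (C2-suc a) ⟨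
    suc a C 2 + b C 2 + suc a * b         ∎
    where
    open ≡-Reasoning
    regroup : ∀ p q a b → p + q + a * b + (a + b) ≡ (p + a) + q + suc a * b
    regroup = solve-∀

  C2-double : ∀ j → j C 2 + j C 2 + j ≡ j * j
  C2-double zero = refl
  C2-double (suc j) = begin
    suc j C 2 + suc j C 2 + suc j        ≡⟨ cong (λ t → t + t + suc j) (C2-suc j) ⟩
    (j C 2 + j) + (j C 2 + j) + suc j    ≡⟨ regroup (j C 2) j ⟩
    (j C 2 + j C 2 + j) + (j + suc j)    ≡⟨ cong (_+ (j + suc j)) (C2-double j) ⟩
    j * j + (j + suc j)                  ≡⟨ square j ⟩
    suc j * suc j                        ∎
    where
    open ≡-Reasoning
    regroup : ∀ t j → (t + j) + (t + j) + suc j ≡ (t + t + j) + (j + suc j)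
    regroup = solve-∀
    square : ∀ j → j * j + (j + suc j) ≡ suc j * suc j
    square = solve-∀

module GaussianBinomials where

  open PowerSeries
  open Truncation
  open Monomials
  open FiniteSums
  open Choose2 using (C2-suc)
  open import Data.Integer using (1ℤ)
  open import Data.Nat as ℕ using (ℕ; zero; suc; _<_; _≤_; z≤n; s≤s; NonZero)
  open import Data.Nat.Combinatorics using (_C_)
  open import Data.Product using (_,_)

  open CommutativeRing SeriesRing
    using (+-cong; +-congˡ; +-identityˡ; +-identityʳ; -‿cong; *-congˡ; *-congʳ; *-identityˡ; *-identityʳ;
           distribˡ; distribʳ; reflexive)

  module QBinomial (Q : Series) where

    -- gauss a b is the Gaussian binomial coefficient [a + b choose a]_Q.
    gauss : ℕ → ℕ → Series
    gauss zero b = 1ₛ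
    gauss (suc a) zero = 1ₛ
    gauss (suc a) (suc b) = gauss (suc a) b ⊕ Q ^ suc b ⊛ gauss a (suc b)

    gauss-zeroʳ : ∀ a → gauss a 0 ≋ 1ₛ
    gauss-zeroʳ zero = ≋-refl
    gauss-zeroʳ (suc a) = ≋-refl

    poch : ℕ → Series
    poch n = ∏ n (λ i → 1ₛ ⊕ ⊝ Q ^ suc i)

    poch-suc : ∀ n → poch (suc n) ≋ poch n ⊛ (1ₛ ⊕ ⊝ Q ^ suc n)
    poch-suc n = ∏-last n (λ i → 1ₛ ⊕ ⊝ Q ^ suc i)

    gauss-poch : ∀ a b → gauss a b ⊛ (poch a ⊛ poch b) ≋ poch (a ℕ.+ b)
    gauss-poch zero b = ≋-trans (*-identityˡ _) (*-identityˡ (poch b))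
    gauss-poch (suc a) zero = begin
      1ₛ ⊛ (poch (suc a) ⊛ 1ₛ)  ≈⟨ *-identityˡ _ ⟩
      poch (suc a) ⊛ 1ₛ         ≈⟨ *-identityʳ (poch (suc a)) ⟩
      poch (suc a)              ≡⟨ cong poch (ℕ.+-identityʳ (suc a)) ⟨
      poch (suc a ℕ.+ 0)        ∎
      where open ≋-Reasoning
    gauss-poch (suc a) (suc b) = begin
      (G₁ ⊕ Q ^ suc b ⊛ G₂) ⊛ (poch (suc a) ⊛ poch (suc b))
        ≈⟨ distribʳ (poch (suc a) ⊛ poch (suc b)) G₁ (Q ^ suc b ⊛ G₂) ⟩
      G₁ ⊛ (poch (suc a) ⊛ poch (suc b)) ⊕ Q ^ suc b ⊛ G₂ ⊛ (poch (suc a) ⊛ poch (suc b))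
        ≈⟨ +-cong (≋-trans (*-congˡ (*-congˡ (poch-suc b))) (peel-b G₁ (poch (suc a)) (poch b) Fb))
                  (≋-trans (*-congˡ (*-congʳ (poch-suc a))) (peel-a (Q ^ suc b) G₂ (poch a) Fa (poch (suc b)))) ⟩
      G₁ ⊛ (poch (suc a) ⊛ poch b) ⊛ Fb ⊕ Q ^ suc b ⊛ (G₂ ⊛ (poch a ⊛ poch (suc b))) ⊛ Fa
        ≈⟨ +-cong (*-congʳ (≋-trans (gauss-poch (suc a) b) (reflexive (cong poch (sym (ℕ.+-suc a b))))))
                  (*-congʳ (*-congˡ (gauss-poch a (suc b)))) ⟩
      W ⊛ Fb ⊕ Q ^ suc b ⊛ W ⊛ Fa
        ≈⟨ combine W (Q ^ suc a) (Q ^ suc b) ⟩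
      W ⊛ (1ₛ ⊕ ⊝ (Q ^ suc a ⊛ Q ^ suc b))
        ≈⟨ *-congˡ (+-congˡ {1ₛ} (-‿cong (≋-sym (^-homo-* Q (suc a) (suc b))))) ⟩
      W ⊛ (1ₛ ⊕ ⊝ Q ^ (suc a ℕ.+ suc b))
        ≈⟨ poch-suc (a ℕ.+ suc b) ⟨
      poch (suc a ℕ.+ suc b) ∎
      where
      open ≋-Reasoning
      open SeriesSolver
      G₁ G₂ Fa Fb W : Series
      G₁ = gauss (suc a) b
      G₂ = gauss a (suc b)
      Fa = 1ₛ ⊕ ⊝ Q ^ suc a
      Fb = 1ₛ ⊕ ⊝ Q ^ suc b
      W = poch (a ℕ.+ suc b)
      peel-b : ∀ G A B F → G ⊛ (A ⊛ (B ⊛ F)) ≋ G ⊛ (A ⊛ B) ⊛ F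
      peel-b = solve 4 (λ G A B F → G :* (A :* (B :* F)) := G :* (A :* B) :* F) ≋-refl
      peel-a : ∀ q G A F B → q ⊛ G ⊛ (A ⊛ F ⊛ B) ≋ q ⊛ (G ⊛ (A ⊛ B)) ⊛ F
      peel-a = solve 5 (λ q G A F B → q :* G :* (A :* F :* B) := q :* (G :* (A :* B)) :* F) ≋-refl
      combine : ∀ W qa qb → W ⊛ (1ₛ ⊕ ⊝ qb) ⊕ qb ⊛ W ⊛ (1ₛ ⊕ ⊝ qa) ≋
                            W ⊛ (1ₛ ⊕ ⊝ (qa ⊛ qb))
      combine = solve 3 (λ W qa qb → W :* (con 1ℤ :+ :- qb) :+ qb :* W :* (con 1ℤ :+ :- qa)
                                      := W :* (con 1ℤ :+ :- (qa :* qb))) ≋-refl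

    ^-C2-suc : ∀ a → Q ^ (suc a C 2) ≋ Q ^ (a C 2) ⊛ Q ^ a
    ^-C2-suc a = ≋-trans (reflexive (cong (Q ^_) (C2-suc a))) (^-homo-* Q (a C 2) a)

    module Cauchy (x y : Series) where

      term : ℕ → ℕ → Series
      term a b = gauss a b ⊛ (sign a ⊛ (Q ^ (a C 2) ⊛ (x ^ a ⊛ y ^ b)))

      factor : ℕ → Series
      factor i = y ⊕ ⊝ (x ⊛ Q ^ i)

      cauchy : ∀ N → ∏ N factor ≋ antidiagonal N term
      cauchy zero = ≋-sym (≋-trans (+-identityʳ _) ones)
        where
        open SeriesSolver
        ones : 1ₛ ⊛ (1ₛ ⊛ (1ₛ ⊛ (1ₛ ⊛ 1ₛ))) ≋ 1ₛ
        ones = solve 0 (con 1ℤ :* (con 1ℤ :* (con 1ℤ :* (con 1ℤ :* con 1ℤ))) := con 1ℤ) ≋-refl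
      cauchy (suc N) = begin
        ∏ (suc N) factor
          ≈⟨ ∏-last N factor ⟩
        ∏ N factor ⊛ factor N
          ≈⟨ *-congʳ (cauchy N) ⟩
        antidiagonal N term ⊛ (y ⊕ ⊝ (x ⊛ Q ^ N))
          ≈⟨ distribˡ (antidiagonal N term) y (⊝ (x ⊛ Q ^ N)) ⟩
        antidiagonal N term ⊛ y ⊕ antidiagonal N term ⊛ ⊝ (x ⊛ Q ^ N)
          ≈⟨ +-cong (∑ₛ-⊛-distribʳ (suc N) T y) (∑ₛ-⊛-distribʳ (suc N) T (⊝ (x ⊛ Q ^ N))) ⟩
        antidiagonal N U ⊕ antidiagonal N V
          ≈⟨ antidiagonal-suc N U V ⟨
        antidiagonal (suc N) (λ a b → shiftSnd U a b ⊕ shiftFst V a b)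
          ≈⟨ antidiagonal-cong (suc N) pascal ⟨
        antidiagonal (suc N) term ∎
        where
        open ≋-Reasoning
        open SeriesSolver
        T : ℕ → Series
        T a = term a (N ℕ.∸ a)
        U V : ℕ → ℕ → Series
        U a b = term a b ⊛ y
        V a b = term a b ⊛ ⊝ (x ⊛ Q ^ N)

        pascal : ∀ a b → a ℕ.+ b ≡ suc N → term a b ≋ shiftSnd U a b ⊕ shiftFst V a b
        pascal zero (suc b) _ = ≋-trans (shuffle y (y ^ b)) (≋-sym (+-identityʳ _))
          where
          shuffle : ∀ y yᵇ → 1ₛ ⊛ (1ₛ ⊛ (1ₛ ⊛ (1ₛ ⊛ (y ⊛ yᵇ)))) ≋
                             1ₛ ⊛ (1ₛ ⊛ (1ₛ ⊛ (1ₛ ⊛ yᵇ))) ⊛ y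
          shuffle = solve 2 (λ y yᵇ → con 1ℤ :* (con 1ℤ :* (con 1ℤ :* (con 1ℤ :* (y :* yᵇ))))
                                    := con 1ℤ :* (con 1ℤ :* (con 1ℤ :* (con 1ℤ :* yᵇ))) :* y) ≋-refl
        pascal (suc a) zero eq with ℕ.suc-injective (trans (sym (ℕ.+-identityʳ (suc a))) eq)
        ... | refl = begin
          1ₛ ⊛ (⊝ 1ₛ ⊛ sign N ⊛ (Q ^ (suc N C 2) ⊛ (x ⊛ x ^ N ⊛ 1ₛ)))
            ≈⟨ *-congˡ (*-congˡ (*-congʳ (^-C2-suc N))) ⟩
          1ₛ ⊛ (⊝ 1ₛ ⊛ sign N ⊛ (Q ^ (N C 2) ⊛ Q ^ N ⊛ (x ⊛ x ^ N ⊛ 1ₛ)))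
            ≈⟨ shuffle (sign N) (Q ^ (N C 2)) (Q ^ N) x (x ^ N) ⟩
          1ₛ ⊛ (sign N ⊛ (Q ^ (N C 2) ⊛ (x ^ N ⊛ 1ₛ))) ⊛ ⊝ (x ⊛ Q ^ N)
            ≈⟨ *-congʳ (*-congʳ (gauss-zeroʳ N)) ⟨
          V N 0
            ≈⟨ +-identityˡ (V N 0) ⟨
          0ₛ ⊕ V N 0 ∎
          where
          shuffle : ∀ s qt q x xᴺ → 1ₛ ⊛ (⊝ 1ₛ ⊛ s ⊛ (qt ⊛ q ⊛ (x ⊛ xᴺ ⊛ 1ₛ))) ≋
                                     1ₛ ⊛ (s ⊛ (qt ⊛ (xᴺ ⊛ 1ₛ))) ⊛ ⊝ (x ⊛ q)
          shuffle = solve 5 (λ s qt q x xᴺ →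
            con 1ℤ :* (:- con 1ℤ :* s :* (qt :* q :* (x :* xᴺ :* con 1ℤ))) :=
            con 1ℤ :* (s :* (qt :* (xᴺ :* con 1ℤ))) :* :- (x :* q)) ≋-refl
        pascal (suc a) (suc b) eq with ℕ.suc-injective eq
        ... | refl = begin
          (G₁ ⊕ Q ^ suc b ⊛ G₂) ⊛ (⊝ 1ₛ ⊛ sign a ⊛ (Q ^ (suc a C 2) ⊛ (x ⊛ x ^ a ⊛ (y ⊛ y ^ b))))
            ≈⟨ *-congˡ (*-congˡ (*-congʳ (^-C2-suc a))) ⟩
          (G₁ ⊕ Q ^ suc b ⊛ G₂) ⊛ (⊝ 1ₛ ⊛ sign a ⊛ (Q ^ (a C 2) ⊛ Q ^ a ⊛ (x ⊛ x ^ a ⊛ (y ⊛ y ^ b))))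
            ≈⟨ shuffle G₁ G₂ (sign a) (Q ^ (a C 2)) (Q ^ a) (Q ^ suc b) x (x ^ a) y (y ^ b) ⟩
          G₁ ⊛ (⊝ 1ₛ ⊛ sign a ⊛ (Q ^ (a C 2) ⊛ Q ^ a ⊛ (x ⊛ x ^ a ⊛ y ^ b))) ⊛ y
            ⊕ G₂ ⊛ (sign a ⊛ (Q ^ (a C 2) ⊛ (x ^ a ⊛ (y ⊛ y ^ b)))) ⊛ ⊝ (x ⊛ (Q ^ a ⊛ Q ^ suc b))
            ≈⟨ +-cong (*-congʳ (*-congˡ (*-congˡ (*-congʳ (^-C2-suc a)))))
                      (*-congˡ (-‿cong (*-congˡ (^-homo-* Q a (suc b))))) ⟨
          U (suc a) b ⊕ V a (suc b) ∎
          where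
          G₁ G₂ : Series
          G₁ = gauss (suc a) b
          G₂ = gauss a (suc b)
          shuffle : ∀ G₁ G₂ s qt qa qsb x xᵃ y yᵇ →
            (G₁ ⊕ qsb ⊛ G₂) ⊛ (⊝ 1ₛ ⊛ s ⊛ (qt ⊛ qa ⊛ (x ⊛ xᵃ ⊛ (y ⊛ yᵇ)))) ≋
            G₁ ⊛ (⊝ 1ₛ ⊛ s ⊛ (qt ⊛ qa ⊛ (x ⊛ xᵃ ⊛ yᵇ))) ⊛ y
              ⊕ G₂ ⊛ (s ⊛ (qt ⊛ (xᵃ ⊛ (y ⊛ yᵇ)))) ⊛ ⊝ (x ⊛ (qa ⊛ qsb))
          shuffle = solve 10 (λ G₁ G₂ s qt qa qsb x xᵃ y yᵇ →
            (G₁ :+ qsb :* G₂) :* (:- con 1ℤ :* s :* (qt :* qa :* (x :* xᵃ :* (y :* yᵇ)))) :=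
            G₁ :* (:- con 1ℤ :* s :* (qt :* qa :* (x :* xᵃ :* yᵇ))) :* y
              :+ G₂ :* (s :* (qt :* (xᵃ :* (y :* yᵇ)))) :* :- (x :* (qa :* qsb))) ≋-refl

  module GaussTruncation (m : ℕ) .{{_ : NonZero m}} where

    open QBinomial (X ^ m)

    1-Q^≈[]1 : ∀ k → 1ₛ ⊕ ⊝ (X ^ m) ^ k ≈[ m ℕ.* k ] 1ₛ
    1-Q^≈[]1 k = ≈[]-trans (≋⇒≈[] _ (+-congˡ {1ₛ} (-‿cong (^-assocʳ X m k)))) (1-X^≈[]1 (m ℕ.* k))

    poch-+-≈[] : ∀ t u → poch (t ℕ.+ u) ≈[ m ℕ.* suc t ] poch t
    poch-+-≈[] t zero = ≋⇒≈[] _ (reflexive (cong poch (ℕ.+-identityʳ t)))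
    poch-+-≈[] t (suc u) = begin
      poch (t ℕ.+ suc u)
        ≡⟨ cong poch (ℕ.+-suc t u) ⟩
      poch (suc (t ℕ.+ u))
        ≈⟨ ≋⇒≈[] _ (poch-suc (t ℕ.+ u)) ⟩
      poch (t ℕ.+ u) ⊛ (1ₛ ⊕ ⊝ (X ^ m) ^ suc (t ℕ.+ u))
        ≈⟨ ≈[]-⊛ (poch-+-≈[] t u)
                 (≈[]-weaken (ℕ.*-monoʳ-≤ m (s≤s (ℕ.m≤m+n t u))) (1-Q^≈[]1 (suc (t ℕ.+ u)))) ⟩
      poch t ⊛ 1ₛ
        ≈⟨ ≋⇒≈[] _ (*-identityʳ (poch t)) ⟩
      poch t ∎
      where open SetoidReasoning (≈[]-setoid (m ℕ.* suc t))

    poch-≈[] : ∀ {t n} → t ≤ n → poch n ≈[ m ℕ.* suc t ] poch t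
    poch-≈[] {t} t≤n with ℕ.m≤n⇒∃[o]m+o≡n t≤n
    ... | u , refl = poch-+-≈[] t u

    poch-coeff-0 : ∀ n → poch n 0 ≡ 1ℤ
    poch-coeff-0 n = coeff< (poch-≈[] {n = n} z≤n) (subst (0 <_) (sym (ℕ.*-identityʳ m)) (ℕ.>-nonZero⁻¹ m))

    -- gauss a b ⊛ poch a ⊛ poch b = poch (a + b), and poch n agrees with poch t modulo X^{m (t + 1)}
    -- for n ≥ t; so cancel poch t.
    gauss-≈[]1 : ∀ {a b c t} → t ≤ a → t ≤ b → t ≤ c → gauss a b ⊛ poch c ≈[ m ℕ.* suc t ] 1ₛ
    gauss-≈[]1 {a} {b} {c} {t} t≤a t≤b t≤c = begin
      gauss a b ⊛ poch c  ≈⟨ ≈[]-⊛ ≈[]-refl (poch-≈[] t≤c) ⟩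
      gauss a b ⊛ poch t  ≈⟨ ⊛-cancelˡ (poch-coeff-0 t) cancellable ⟩
      1ₛ                  ∎
      where
      open SetoidReasoning (≈[]-setoid (m ℕ.* suc t))
      open SeriesSolver using (solve; _:=_; _:*_)
      swap : ∀ p g → p ⊛ (g ⊛ p) ≋ g ⊛ (p ⊛ p)
      swap = solve 2 (λ p g → p :* (g :* p) := g :* (p :* p)) ≋-refl
      cancellable : poch t ⊛ (gauss a b ⊛ poch t) ≈[ m ℕ.* suc t ] poch t ⊛ 1ₛ
      cancellable = begin
        poch t ⊛ (gauss a b ⊛ poch t)  ≈⟨ ≋⇒≈[] _ (swap (poch t) (gauss a b)) ⟩
        gauss a b ⊛ (poch t ⊛ poch t)  ≈⟨ ≈[]-⊛ ≈[]-refl (≈[]-⊛ (≈[]-sym (poch-≈[] t≤a))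
                                                                (≈[]-sym (poch-≈[] t≤b))) ⟩
        gauss a b ⊛ (poch a ⊛ poch b)  ≈⟨ ≋⇒≈[] _ (gauss-poch a b) ⟩
        poch (a ℕ.+ b)                 ≈⟨ poch-≈[] (ℕ.≤-trans t≤a (ℕ.m≤m+n a b)) ⟩
        poch t                         ≈⟨ ≋⇒≈[] _ (≋-sym (*-identityʳ (poch t))) ⟩
        poch t ⊛ 1ₛ                    ∎

module TripleProduct (r : ℕ) where

  open PowerSeries
  open Truncation
  open Monomials
  open FiniteSums
  open LogarithmicDerivative
    using (H; HasLogDerivative; hasLogDerivative-∏; hasLogDerivative-⊛; hasLogDerivative-1-X^)
  open Choose2
  open GaussianBinomials
  open import Data.Integer using (1ℤ)
  open import Data.Nat as ℕ using (ℕ; zero; suc; _+_; _*_; _<_; _≤_; _∸_; z≤n; s≤s)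
  open import Data.Nat.Tactic.RingSolver using (solve-∀)
  open import Data.Nat.Combinatorics using (_C_)

  open CommutativeRing SeriesRing
    using (+-cong; +-congˡ; +-congʳ; -‿cong; *-cong; *-congˡ; *-congʳ; *-identityˡ; *-identityʳ; *-assoc; reflexive)

  m : ℕ
  m = 2 + r

  q : Series
  q = X ^ m

  open QBinomial q
  module Binomial (M : ℕ) = Cauchy X (q ^ M)

  A⁺ A⁻ A⁰ : ℕ → Series
  A⁺ k = 1ₛ ⊕ ⊝ X ^ suc (m * k)
  A⁻ k = 1ₛ ⊕ ⊝ X ^ (m * k + suc r)
  A⁰ k = 1ₛ ⊕ ⊝ X ^ (m * suc k)

  jacobiProduct : ℕ → Series
  jacobiProduct M = ∏ M (λ k → A⁺ k ⊛ A⁻ k ⊛ A⁰ k)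

  X⊛q^ : ∀ i → X ⊛ q ^ i ≋ X ^ suc (m * i)
  X⊛q^ i = *-congˡ (^-assocʳ X m i)

  lowFactor : ∀ {M i s} → i + suc s ≡ M → q ^ M ⊕ ⊝ (X ⊛ q ^ i) ≋ ⊝ (X ⊛ q ^ i) ⊛ A⁻ s
  lowFactor {M} {i} {s} refl = begin
    q ^ (i + suc s) ⊕ ⊝ (X ⊛ q ^ i)
      ≈⟨ +-congʳ {⊝ (X ⊛ q ^ i)} (^-homo-* q i (suc s)) ⟩
    q ^ i ⊛ q ^ suc s ⊕ ⊝ (X ⊛ q ^ i)
      ≈⟨ +-congʳ {⊝ (X ⊛ q ^ i)} (*-congˡ q^suc) ⟩
    q ^ i ⊛ (X ⊛ X ^ (m * s + suc r)) ⊕ ⊝ (X ⊛ q ^ i)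
      ≈⟨ factorOut (q ^ i) X (X ^ (m * s + suc r)) ⟩
    ⊝ (X ⊛ q ^ i) ⊛ A⁻ s ∎
    where
    open ≋-Reasoning
    open SeriesSolver
    split : m * suc s ≡ suc (m * s + suc r)
    split = identity r s
      where
      identity : ∀ r s → (2 + r) * suc s ≡ suc ((2 + r) * s + suc r)
      identity = solve-∀
    q^suc : q ^ suc s ≋ X ⊛ X ^ (m * s + suc r)
    q^suc = ≋-trans (^-assocʳ X m (suc s)) (reflexive (cong (X ^_) split))
    factorOut : ∀ q x z → q ⊛ (x ⊛ z) ⊕ ⊝ (x ⊛ q) ≋ ⊝ (x ⊛ q) ⊛ (1ₛ ⊕ ⊝ z)
    factorOut = solve 3 (λ q x z → q :* (x :* z) :+ :- (x :* q) := :- (x :* q) :* (con 1ℤ :+ :- z)) ≋-refl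

  highFactor : ∀ M i → q ^ M ⊕ ⊝ (X ⊛ q ^ (M + i)) ≋ q ^ M ⊛ A⁺ i
  highFactor M i = begin
    q ^ M ⊕ ⊝ (X ⊛ q ^ (M + i))         ≈⟨ +-congˡ {q ^ M} (-‿cong (*-congˡ (^-homo-* q M i))) ⟩
    q ^ M ⊕ ⊝ (X ⊛ (q ^ M ⊛ q ^ i))     ≈⟨ factorOut (q ^ M) X (q ^ i) ⟩
    q ^ M ⊛ (1ₛ ⊕ ⊝ (X ⊛ q ^ i))        ≈⟨ *-congˡ (+-congˡ {1ₛ} (-‿cong (X⊛q^ i))) ⟩
    q ^ M ⊛ A⁺ i                        ∎
    where
    open ≋-Reasoning
    open SeriesSolver
    factorOut : ∀ y x q → y ⊕ ⊝ (x ⊛ (y ⊛ q)) ≋ y ⊛ (1ₛ ⊕ ⊝ (x ⊛ q))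
    factorOut = solve 3 (λ y x q → y :+ :- (x :* (y :* q)) := y :* (con 1ℤ :+ :- (x :* q))) ≋-refl

  ∏-negMonomials : ∀ M → ∏ M (λ i → ⊝ (X ⊛ q ^ i)) ≋ sign M ⊛ X ^ (M + m * (M C 2))
  ∏-negMonomials zero = ≋-sym (≋-trans (*-congˡ (reflexive (cong (X ^_) (ℕ.*-zeroʳ m)))) (*-identityˡ 1ₛ))
  ∏-negMonomials (suc M) = begin
    ∏ (suc M) (λ i → ⊝ (X ⊛ q ^ i))
      ≈⟨ ∏-last M (λ i → ⊝ (X ⊛ q ^ i)) ⟩
    ∏ M (λ i → ⊝ (X ⊛ q ^ i)) ⊛ ⊝ (X ⊛ q ^ M)
      ≈⟨ *-cong (∏-negMonomials M) (-‿cong (X⊛q^ M)) ⟩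
    sign M ⊛ X ^ e ⊛ ⊝ X ^ suc (m * M)
      ≈⟨ regroup (sign M) (X ^ e) (X ^ suc (m * M)) ⟩
    ⊝ 1ₛ ⊛ sign M ⊛ (X ^ e ⊛ X ^ suc (m * M))
      ≈⟨ *-congˡ (^-homo-* X e (suc (m * M))) ⟨
    sign (suc M) ⊛ X ^ (e + suc (m * M))
      ≡⟨ cong (λ k → sign (suc M) ⊛ X ^ k) (exponent M (M C 2)) ⟩
    sign (suc M) ⊛ X ^ (suc M + m * (M C 2 + M))
      ≡⟨ cong (λ k → sign (suc M) ⊛ X ^ (suc M + m * k)) (C2-suc M) ⟨
    sign (suc M) ⊛ X ^ (suc M + m * (suc M C 2)) ∎
    where
    open ≋-Reasoning
    open SeriesSolver
    e : ℕ
    e = M + m * (M C 2)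
    regroup : ∀ s a b → s ⊛ a ⊛ ⊝ b ≋ ⊝ 1ₛ ⊛ s ⊛ (a ⊛ b)
    regroup = solve 3 (λ s a b → s :* a :* :- b := :- con 1ℤ :* s :* (a :* b)) ≋-refl
    exponent : ∀ M t → M + m * t + suc (m * M) ≡ suc M + m * (t + M)
    exponent M t = identity r M t
      where
      identity : ∀ r M t → M + (2 + r) * t + suc ((2 + r) * M) ≡ suc M + (2 + r) * (t + M)
      identity = solve-∀

  offset : ℕ → ℕ
  offset M = M + m * (M C 2) + m * M * M

  offsetMonomial : ℕ → Series
  offsetMonomial M = sign M ⊛ X ^ offset M

  -- Of the factors q^M - X qⁱ (i < 2M), the first M give the A⁻ (in reverse order) and the last M
  -- the A⁺, each up to a monomial.
  factorization : ∀ M → ∏ (M + M) (Binomial.factor M) ≋ offsetMonomial M ⊛ (∏ M A⁺ ⊛ ∏ M A⁻)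
  factorization M = begin
    ∏ (M + M) (Binomial.factor M)
      ≈⟨ ∏-split M M (Binomial.factor M) ⟩
    ∏ M (Binomial.factor M) ⊛ ∏ M (λ i → Binomial.factor M (M + i))
      ≈⟨ *-cong low high ⟩
    sign M ⊛ X ^ e ⊛ ∏ M A⁻ ⊛ (X ^ (m * M * M) ⊛ ∏ M A⁺)
      ≈⟨ regroup (sign M) (X ^ e) (∏ M A⁻) (X ^ (m * M * M)) (∏ M A⁺) ⟩
    sign M ⊛ (X ^ e ⊛ X ^ (m * M * M)) ⊛ (∏ M A⁺ ⊛ ∏ M A⁻)
      ≈⟨ *-congʳ (*-congˡ (^-homo-* X e (m * M * M))) ⟨
    offsetMonomial M ⊛ (∏ M A⁺ ⊛ ∏ M A⁻) ∎
    where
    open ≋-Reasoning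
    open SeriesSolver
    e : ℕ
    e = M + m * (M C 2)
    regroup : ∀ s x a y b → s ⊛ x ⊛ a ⊛ (y ⊛ b) ≋ s ⊛ (x ⊛ y) ⊛ (b ⊛ a)
    regroup = solve 5 (λ s x a y b → s :* x :* a :* (y :* b) := s :* (x :* y) :* (b :* a)) ≋-refl
    low : ∏ M (Binomial.factor M) ≋ sign M ⊛ X ^ e ⊛ ∏ M A⁻
    low = begin
      ∏ M (Binomial.factor M)
        ≈⟨ ∏-cong M (λ {i} i<M → lowFactor (trans (ℕ.+-suc i (M ∸ suc i)) (ℕ.m+[n∸m]≡n i<M))) ⟩
      ∏ M (λ i → ⊝ (X ⊛ q ^ i) ⊛ A⁻ (M ∸ suc i))
        ≈⟨ ∏-distrib M (λ i → ⊝ (X ⊛ q ^ i)) (λ i → A⁻ (M ∸ suc i)) ⟩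
      ∏ M (λ i → ⊝ (X ⊛ q ^ i)) ⊛ ∏ M (λ i → A⁻ (M ∸ suc i))
        ≈⟨ *-cong (∏-negMonomials M) (∏-reverse M A⁻) ⟩
      sign M ⊛ X ^ e ⊛ ∏ M A⁻ ∎
    high : ∏ M (λ i → Binomial.factor M (M + i)) ≋ X ^ (m * M * M) ⊛ ∏ M A⁺
    high = begin
      ∏ M (λ i → Binomial.factor M (M + i))  ≈⟨ ∏-cong M (λ {i} _ → highFactor M i) ⟩
      ∏ M (λ i → q ^ M ⊛ A⁺ i)               ≈⟨ ∏-distrib M (λ _ → q ^ M) A⁺ ⟩
      ∏ M (λ _ → q ^ M) ⊛ ∏ M A⁺              ≈⟨ *-congʳ (≋-trans (∏-const M (q ^ M)) q^M^M) ⟩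
      X ^ (m * M * M) ⊛ ∏ M A⁺                ∎
      where
      q^M^M : (q ^ M) ^ M ≋ X ^ (m * M * M)
      q^M^M = ≋-trans (^-congˡ M (^-assocʳ X m M)) (^-assocʳ X (m * M) M)

  jacobiProduct-split : ∀ M → jacobiProduct M ≋ ∏ M A⁺ ⊛ ∏ M A⁻ ⊛ poch M
  jacobiProduct-split M = begin
    ∏ M (λ k → A⁺ k ⊛ A⁻ k ⊛ A⁰ k)
      ≈⟨ ∏-distrib M (λ k → A⁺ k ⊛ A⁻ k) A⁰ ⟩
    ∏ M (λ k → A⁺ k ⊛ A⁻ k) ⊛ ∏ M A⁰
      ≈⟨ *-cong (∏-distrib M A⁺ A⁻) (∏-cong M (λ {k} _ → A⁰-poch k)) ⟩
    ∏ M A⁺ ⊛ ∏ M A⁻ ⊛ poch M ∎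
    where
    open ≋-Reasoning
    A⁰-poch : ∀ k → A⁰ k ≋ 1ₛ ⊕ ⊝ q ^ suc k
    A⁰-poch k = +-congˡ {1ₛ} (-‿cong (≋-sym (^-assocʳ X m (suc k))))

  jacobi-expansion : ∀ M → offsetMonomial M ⊛ jacobiProduct M ≋
                           antidiagonal (M + M) (λ a b → Binomial.term M a b ⊛ poch M)
  jacobi-expansion M = begin
    offsetMonomial M ⊛ jacobiProduct M
      ≈⟨ *-congˡ (jacobiProduct-split M) ⟩
    offsetMonomial M ⊛ (∏ M A⁺ ⊛ ∏ M A⁻ ⊛ poch M)
      ≈⟨ *-assoc (offsetMonomial M) (∏ M A⁺ ⊛ ∏ M A⁻) (poch M) ⟨
    offsetMonomial M ⊛ (∏ M A⁺ ⊛ ∏ M A⁻) ⊛ poch M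
      ≈⟨ *-congʳ (factorization M) ⟨
    ∏ (M + M) (Binomial.factor M) ⊛ poch M
      ≈⟨ *-congʳ (Binomial.cauchy M (M + M)) ⟩
    antidiagonal (M + M) (Binomial.term M) ⊛ poch M
      ≈⟨ ∑ₛ-⊛-distribʳ (suc (M + M)) (λ a → Binomial.term M a (M + M ∸ a)) (poch M) ⟩
    antidiagonal (M + M) (λ a b → Binomial.term M a b ⊛ poch M) ∎
    where open ≋-Reasoning

  open GaussTruncation m

  θ⁺ θ⁻ : ℕ → ℕ
  θ⁺ k = m * (k C 2) + k
  θ⁻ j = m * (j C 2) + suc r * j

  θ⁺-zero : θ⁺ 0 ≡ 0
  θ⁺-zero = trans (ℕ.+-identityʳ (m * 0)) (ℕ.*-zeroʳ m)

  θ⁺-≥ : ∀ k → k ≤ θ⁺ k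
  θ⁺-≥ k = ℕ.m≤n+m k (m * (k C 2))

  θ⁻-≥ : ∀ k → k ≤ θ⁻ k
  θ⁻-≥ k = ℕ.≤-trans (ℕ.m≤n*m k (suc r)) (ℕ.m≤n+m (suc r * k) (m * (k C 2)))

  monomial : ∀ A B D M → q ^ A ⊛ (X ^ B ⊛ (q ^ M) ^ D) ≋ X ^ (m * A + (B + m * M * D))
  monomial A B D M = begin
    q ^ A ⊛ (X ^ B ⊛ (q ^ M) ^ D)
      ≈⟨ *-cong (^-assocʳ X m A) (*-congˡ (≋-trans (^-congˡ D (^-assocʳ X m M)) (^-assocʳ X (m * M) D))) ⟩
    X ^ (m * A) ⊛ (X ^ B ⊛ X ^ (m * M * D))
      ≈⟨ *-congˡ (^-homo-* X B (m * M * D)) ⟨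
    X ^ (m * A) ⊛ X ^ (B + m * M * D)
      ≈⟨ ^-homo-* X (m * A) (B + m * M * D) ⟨
    X ^ (m * A + (B + m * M * D)) ∎
    where open ≋-Reasoning

  termLeading : ∀ {M a b t} → t ≤ a → t ≤ b → t ≤ M →
                Binomial.term M a b ⊛ poch M ≈[ m * (a C 2) + (a + m * M * b) + m * suc t ]
                  sign a ⊛ X ^ (m * (a C 2) + (a + m * M * b))
  termLeading {M} {a} {b} {t} t≤a t≤b t≤M = begin
    gauss a b ⊛ (sign a ⊛ (q ^ (a C 2) ⊛ (X ^ a ⊛ (q ^ M) ^ b))) ⊛ poch M
      ≈⟨ ≋⇒≈[] _ (regroup (gauss a b) (sign a) (q ^ (a C 2) ⊛ (X ^ a ⊛ (q ^ M) ^ b)) (poch M)) ⟩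
    gauss a b ⊛ poch M ⊛ (sign a ⊛ (q ^ (a C 2) ⊛ (X ^ a ⊛ (q ^ M) ^ b)))
      ≈⟨ ≋⇒≈[] _ (*-congˡ (*-congˡ (monomial (a C 2) a b M))) ⟩
    gauss a b ⊛ poch M ⊛ (sign a ⊛ X ^ E)
      ≈⟨ ≈[]-⊛-X^ E (sign a) (gauss-≈[]1 t≤a t≤b t≤M) ⟩
    1ₛ ⊛ (sign a ⊛ X ^ E)
      ≈⟨ ≋⇒≈[] _ (*-identityˡ (sign a ⊛ X ^ E)) ⟩
    sign a ⊛ X ^ E ∎
    where
    open SetoidReasoning (≈[]-setoid _)
    open SeriesSolver
    E : ℕ
    E = m * (a C 2) + (a + m * M * b)
    regroup : ∀ g s z p → g ⊛ (s ⊛ z) ⊛ p ≋ g ⊛ p ⊛ (s ⊛ z)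
    regroup = solve 4 (λ g s z p → g :* (s :* z) :* p := g :* p :* (s :* z)) ≋-refl

  middleSwap : ∀ a b x y → a ⊛ b ⊛ (x ⊛ y) ≋ a ⊛ x ⊛ (b ⊛ y)
  middleSwap = solve 4 (λ a b x y → a :* b :* (x :* y) := a :* x :* (b :* y)) ≋-refl
    where open SeriesSolver

  positiveTerm : ∀ {M k s} → k + s ≡ M →
                 Binomial.term M (M + k) s ⊛ poch M ≈[ offset M + suc M ] offsetMonomial M ⊛ (sign k ⊛ X ^ θ⁺ k)
  positiveTerm {k = k} {s} refl = ≈[]-weaken bound (≈[]-trans leading (≋⇒≈[] _ monomials))
    where
    M E : ℕ
    M = k + s
    E = m * ((M + k) C 2) + ((M + k) + m * M * s)

    leading : Binomial.term M (M + k) s ⊛ poch M ≈[ E + m * suc s ] sign (M + k) ⊛ X ^ E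
    leading = termLeading (ℕ.≤-trans (ℕ.m≤n+m s k) (ℕ.m≤m+n M k)) ℕ.≤-refl (ℕ.m≤n+m s k)

    exponent : E ≡ offset M + θ⁺ k
    exponent = trans (cong (λ t → m * t + ((M + k) + m * M * s)) (C2-+ M k)) (expand r k s (M C 2) (k C 2))
      where
      expand : ∀ r k s p q → (2 + r) * (p + q + (k + s) * k) + ((k + s) + k + (2 + r) * (k + s) * s) ≡
                             (k + s) + (2 + r) * p + (2 + r) * (k + s) * (k + s) + ((2 + r) * q + k)
      expand = solve-∀

    monomials : sign (M + k) ⊛ X ^ E ≋ offsetMonomial M ⊛ (sign k ⊛ X ^ θ⁺ k)
    monomials = begin
      sign (M + k) ⊛ X ^ E
        ≈⟨ *-cong (sign-+ M k) (reflexive (cong (X ^_) exponent)) ⟩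
      sign M ⊛ sign k ⊛ X ^ (offset M + θ⁺ k)
        ≈⟨ *-congˡ (^-homo-* X (offset M) (θ⁺ k)) ⟩
      sign M ⊛ sign k ⊛ (X ^ offset M ⊛ X ^ θ⁺ k)
        ≈⟨ middleSwap (sign M) (sign k) (X ^ offset M) (X ^ θ⁺ k) ⟩
      offsetMonomial M ⊛ (sign k ⊛ X ^ θ⁺ k) ∎
      where open ≋-Reasoning

    bound : offset M + suc M ≤ E + m * suc s
    bound = begin
      offset M + suc M               ≡⟨ cong (offset M +_) (ℕ.+-suc k s) ⟨
      offset M + (k + suc s)         ≤⟨ ℕ.+-monoʳ-≤ (offset M) (ℕ.+-mono-≤ (θ⁺-≥ k) (ℕ.m≤n*m _ m)) ⟩
      offset M + (θ⁺ k + m * suc s)  ≡⟨ ℕ.+-assoc (offset M) (θ⁺ k) (m * suc s) ⟨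
      offset M + θ⁺ k + m * suc s    ≡⟨ cong (_+ m * suc s) exponent ⟨
      E + m * suc s                  ∎
      where open ℕ.≤-Reasoning

  negativeTerm : ∀ {M s j} → s + j ≡ M →
                 Binomial.term M s (M + j) ⊛ poch M ≈[ offset M + suc M ] offsetMonomial M ⊛ (sign j ⊛ X ^ θ⁻ j)
  negativeTerm {s = s} {j} refl = ≈[]-weaken bound (≈[]-trans leading (≋⇒≈[] _ monomials))
    where
    M E : ℕ
    M = s + j
    E = m * (s C 2) + (s + m * M * (M + j))

    leading : Binomial.term M s (M + j) ⊛ poch M ≈[ E + m * suc s ] sign s ⊛ X ^ E
    leading = termLeading ℕ.≤-refl (ℕ.≤-trans (ℕ.m≤m+n s j) (ℕ.m≤m+n M j)) (ℕ.m≤m+n s j)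

    exponent : E ≡ offset M + θ⁻ j
    exponent = begin
      m * (s C 2) + (s + m * M * (M + j))
        ≡⟨ unfold r s j (s C 2) ⟩
      m * (s C 2) + s + m * M * M + m * s * j + m * (j * j)
        ≡⟨ cong (λ t → m * (s C 2) + s + m * M * M + m * s * j + m * t) (C2-double j) ⟨
      m * (s C 2) + s + m * M * M + m * s * j + m * (j C 2 + j C 2 + j)
        ≡⟨ fold r s j (s C 2) (j C 2) ⟩
      M + m * (s C 2 + j C 2 + s * j) + m * M * M + θ⁻ j
        ≡⟨ cong (λ t → M + m * t + m * M * M + θ⁻ j) (C2-+ s j) ⟨
      offset M + θ⁻ j ∎
      where
      open ≡-Reasoning
      unfold : ∀ r s j p → (2 + r) * p + (s + (2 + r) * (s + j) * ((s + j) + j)) ≡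
                           (2 + r) * p + s + (2 + r) * (s + j) * (s + j) + (2 + r) * s * j + (2 + r) * (j * j)
      unfold = solve-∀
      fold : ∀ r s j p q → (2 + r) * p + s + (2 + r) * (s + j) * (s + j) + (2 + r) * s * j + (2 + r) * (q + q + j) ≡
                           (s + j) + (2 + r) * (p + q + s * j) + (2 + r) * (s + j) * (s + j) + ((2 + r) * q + suc r * j)
      fold = solve-∀

    signs : sign M ⊛ sign j ≋ sign s
    signs = begin
      sign (s + j) ⊛ sign j        ≈⟨ *-congʳ (sign-+ s j) ⟩
      sign s ⊛ sign j ⊛ sign j     ≈⟨ *-assoc (sign s) (sign j) (sign j) ⟩
      sign s ⊛ (sign j ⊛ sign j)   ≈⟨ *-congˡ (sign-⊛-sign j) ⟩
      sign s ⊛ 1ₛ                  ≈⟨ *-identityʳ (sign s) ⟩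
      sign s                       ∎
      where open ≋-Reasoning

    monomials : sign s ⊛ X ^ E ≋ offsetMonomial M ⊛ (sign j ⊛ X ^ θ⁻ j)
    monomials = begin
      sign s ⊛ X ^ E
        ≈⟨ *-cong (≋-sym signs) (reflexive (cong (X ^_) exponent)) ⟩
      sign M ⊛ sign j ⊛ X ^ (offset M + θ⁻ j)
        ≈⟨ *-congˡ (^-homo-* X (offset M) (θ⁻ j)) ⟩
      sign M ⊛ sign j ⊛ (X ^ offset M ⊛ X ^ θ⁻ j)
        ≈⟨ middleSwap (sign M) (sign j) (X ^ offset M) (X ^ θ⁻ j) ⟩
      offsetMonomial M ⊛ (sign j ⊛ X ^ θ⁻ j) ∎
      where open ≋-Reasoning

    bound : offset M + suc M ≤ E + m * suc s
    bound = begin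
      offset M + suc M               ≡⟨ cong (offset M +_) (ℕ.+-comm (suc s) j) ⟩
      offset M + (j + suc s)         ≤⟨ ℕ.+-monoʳ-≤ (offset M) (ℕ.+-mono-≤ (θ⁻-≥ j) (ℕ.m≤n*m _ m)) ⟩
      offset M + (θ⁻ j + m * suc s)  ≡⟨ ℕ.+-assoc (offset M) (θ⁻ j) (m * suc s) ⟨
      offset M + θ⁻ j + m * suc s    ≡⟨ cong (_+ m * suc s) exponent ⟨
      E + m * suc s                  ∎
      where open ℕ.≤-Reasoning

  theta : ℕ → Series
  theta M = ∑ₛ (suc M) (λ k → sign k ⊛ X ^ θ⁺ k) ⊕ ∑ₛ M (λ j → sign (suc j) ⊛ X ^ θ⁻ (suc j))

  leadingTerms : ∀ M → offsetMonomial M ⊛ jacobiProduct M ≈[ offset M + suc M ] offsetMonomial M ⊛ theta M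
  leadingTerms M = begin
    offsetMonomial M ⊛ jacobiProduct M
      ≈⟨ ≋⇒≈[] _ (jacobi-expansion M) ⟩
    ∑ₛ (suc (M + M)) (λ a → F a (M + M ∸ a))
      ≡⟨ cong (λ n → ∑ₛ n (λ a → F a (M + M ∸ a))) (sym (ℕ.+-suc M M)) ⟩
    ∑ₛ (M + suc M) (λ a → F a (M + M ∸ a))
      ≈⟨ ≋⇒≈[] _ (∑ₛ-split M (suc M) (λ a → F a (M + M ∸ a))) ⟩
    ∑ₛ M (λ a → F a (M + M ∸ a)) ⊕ ∑ₛ (suc M) (λ k → F (M + k) (M + M ∸ (M + k)))
      ≈⟨ ≈[]-⊕ (∑ₛ-cong-≈[] M negative) (∑ₛ-cong-≈[] (suc M) positive) ⟩
    ∑ₛ M (λ a → μ ⊛ g⁻ (M ∸ a)) ⊕ ∑ₛ (suc M) (λ k → μ ⊛ g⁺ k)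
      ≈⟨ ≋⇒≈[] _ (+-cong (∑ₛ-⊛-distribˡ M (λ a → g⁻ (M ∸ a)) μ)
                         (∑ₛ-⊛-distribˡ (suc M) g⁺ μ)) ⟨
    μ ⊛ ∑ₛ M (λ a → g⁻ (M ∸ a)) ⊕ μ ⊛ ∑ₛ (suc M) g⁺
      ≈⟨ ≋⇒≈[] _ (+-congʳ {μ ⊛ ∑ₛ (suc M) g⁺} (*-congˡ reversal)) ⟩
    μ ⊛ ∑ₛ M (λ j → g⁻ (suc j)) ⊕ μ ⊛ ∑ₛ (suc M) g⁺
      ≈⟨ ≋⇒≈[] _ (collect μ (∑ₛ M (λ j → g⁻ (suc j))) (∑ₛ (suc M) g⁺)) ⟩
    μ ⊛ theta M ∎
    where
    open SetoidReasoning (≈[]-setoid (offset M + suc M))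
    open SeriesSolver
    μ : Series
    μ = offsetMonomial M
    F : ℕ → ℕ → Series
    F a b = Binomial.term M a b ⊛ poch M
    g⁺ g⁻ : ℕ → Series
    g⁺ k = sign k ⊛ X ^ θ⁺ k
    g⁻ j = sign j ⊛ X ^ θ⁻ j

    negative : ∀ {a} → a < M → F a (M + M ∸ a) ≈[ offset M + suc M ] μ ⊛ g⁻ (M ∸ a)
    negative {a} a<M = ≈[]-trans (≋⇒≈[] _ (reflexive (cong (F a) (ℕ.+-∸-assoc M (ℕ.<⇒≤ a<M)))))
                                 (negativeTerm (ℕ.m+[n∸m]≡n (ℕ.<⇒≤ a<M)))

    positive : ∀ {k} → k < suc M → F (M + k) (M + M ∸ (M + k)) ≈[ offset M + suc M ] μ ⊛ g⁺ k
    positive {k} k≤M = ≈[]-trans (≋⇒≈[] _ (reflexive (cong (F (M + k)) (ℕ.[m+n]∸[m+o]≡n∸o M M k))))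
                                 (positiveTerm (ℕ.m+[n∸m]≡n (ℕ.≤-pred k≤M)))

    reversal : ∑ₛ M (λ a → g⁻ (M ∸ a)) ≋ ∑ₛ M (λ j → g⁻ (suc j))
    reversal = ≋-trans (∑ₛ-cong M (λ {a} a<M → reflexive (cong g⁻ (ℕ.+-∸-assoc 1 a<M))))
                       (∑ₛ-reverse M (λ j → g⁻ (suc j)))

    collect : ∀ x n p → x ⊛ n ⊕ x ⊛ p ≋ x ⊛ (p ⊕ n)
    collect = solve 3 (λ x n p → x :* n :+ x :* p := x :* (p :+ n)) ≋-refl

  jacobiProduct≈theta : ∀ M → jacobiProduct M ≈[ suc M ] theta M
  jacobiProduct≈theta M = begin
    jacobiProduct M                      ≈⟨ ≋⇒≈[] _ (unsign (jacobiProduct M)) ⟨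
    sign M ⊛ (sign M ⊛ jacobiProduct M)  ≈⟨ ≈[]-⊛ ≈[]-refl (X^⊛-cancel-≈[] (offset M) shifted) ⟩
    sign M ⊛ (sign M ⊛ theta M)          ≈⟨ ≋⇒≈[] _ (unsign (theta M)) ⟩
    theta M                              ∎
    where
    open SetoidReasoning (≈[]-setoid (suc M))
    open SeriesSolver using (solve; _:=_; _:*_)
    unsign : ∀ f → sign M ⊛ (sign M ⊛ f) ≋ f
    unsign f = ≋-trans (≋-sym (*-assoc (sign M) (sign M) f)) (≋-trans (*-congʳ (sign-⊛-sign M)) (*-identityˡ f))
    swap : ∀ s x f → s ⊛ x ⊛ f ≋ x ⊛ (s ⊛ f)
    swap = solve 3 (λ s x f → s :* x :* f := x :* (s :* f)) ≋-refl
    shifted : X ^ offset M ⊛ (sign M ⊛ jacobiProduct M) ≈[ offset M + suc M ] X ^ offset M ⊛ (sign M ⊛ theta M)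
    shifted = ≈[]-trans (≋⇒≈[] _ (≋-sym (swap (sign M) (X ^ offset M) (jacobiProduct M))))
                (≈[]-trans (leadingTerms M) (≋⇒≈[] _ (swap (sign M) (X ^ offset M) (theta M))))

  jacobiLogDerivative : ℕ → Series
  jacobiLogDerivative M = ∑ₛ M (λ k → ⊝ H (suc (m * k)) ⊕ ⊝ H (m * k + suc r) ⊕ ⊝ H (m * suc k))

  jacobiProduct-logDerivative : ∀ M → HasLogDerivative (jacobiProduct M) (jacobiLogDerivative M)
  jacobiProduct-logDerivative M = hasLogDerivative-∏ M λ k →
    hasLogDerivative-⊛ (hasLogDerivative-⊛ (hasLogDerivative-1-X^ (suc (m * k)) (s≤s z≤n))
                                           (hasLogDerivative-1-X^ (m * k + suc r) (1≤m*k+1+r k)))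
                       (hasLogDerivative-1-X^ (m * suc k) (s≤s z≤n))
    where
    1≤m*k+1+r : ∀ k → 1 ≤ m * k + suc r
    1≤m*k+1+r k = ℕ.≤-trans (s≤s z≤n) (ℕ.m≤n+m (suc r) (m * k))

module StrictlyIncreasing where

  open import Data.Nat as ℕ using (ℕ; suc; _<_; _≤_)
  open import Data.Sum using (inj₁; inj₂)
  open import Relation.Binary.Definitions using (tri<; tri≈; tri>)
  open import Relation.Nullary using (contradiction)

  module _ {f : ℕ → ℕ} (f-step : ∀ k → f k < f (suc k)) where

    step⇒strictMono : ∀ {a b} → a < b → f a < f b
    step⇒strictMono {a} {suc b} a<1+b with ℕ.m<1+n⇒m<n∨m≡n a<1+b
    ... | inj₁ a<b = ℕ.<-trans (step⇒strictMono a<b) (f-step b)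
    ... | inj₂ refl = f-step a

    step⇒mono : ∀ {a b} → a ≤ b → f a ≤ f b
    step⇒mono a≤b with ℕ.m≤n⇒m<n∨m≡n a≤b
    ... | inj₁ a<b = ℕ.<⇒≤ (step⇒strictMono a<b)
    ... | inj₂ refl = ℕ.≤-refl

    step⇒injective : ∀ {a b} → f a ≡ f b → a ≡ b
    step⇒injective {a} {b} fa≡fb with ℕ.<-cmp a b
    ... | tri< a<b _ _ = contradiction fa≡fb (ℕ.<⇒≢ (step⇒strictMono a<b))
    ... | tri≈ _ a≡b _ = a≡b
    ... | tri> _ _ b<a = contradiction (sym fa≡fb) (ℕ.<⇒≢ (step⇒strictMono b<a))

module ThetaCoefficients (r : ℕ) where

  open import Defs using (P; Q; findK; e)
  open PowerSeries
  open Truncation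
  open Monomials
  open FiniteSums
  open StrictlyIncreasing
  open Choose2 using (C2-suc; C2-double)
  open import Data.Integer as ℤ using (ℤ; +_; 0ℤ; 1ℤ; -1ℤ)
  open import Data.List using (List; applyUpTo)
  open import Data.Maybe using (maybe)
  open import Data.Nat as ℕ using (ℕ; zero; suc; _+_; _*_; _∸_; _<_; _≤_; _≰_; s≤s)
  open import Data.Nat.Combinatorics using (_C_)
  open import Data.Nat.DivMod using (_/_; m*n/n≡m)
  open import Data.Nat.Tactic.RingSolver using (solve-∀)
  open import Data.Product using (_,_)
  open import Data.Sum as Sum using (_⊎_; inj₁; inj₂)
  open import Relation.Nullary using (¬_; yes; no; contradiction)
  open import Relation.Nullary.Decidable using (_⊎-dec_)

  open TripleProduct (suc r)

  private
    g∸2 : m + 2 ∸ 2 ≡ m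
    g∸2 = ℕ.m+n∸n≡m m 2

    g∸4 : m + 2 ∸ 4 ≡ suc r
    g∸4 = cong (_∸ 1) (ℕ.+-comm r 2)

  P≡θ⁺ : ∀ k → P (m + 2) k ≡ θ⁺ k
  P≡θ⁺ k = trans (cong₂ (λ a b → (k * (a * k ∸ b)) / 2) g∸2 g∸4)
                 (trans (cong (_/ 2) (double k)) (m*n/n≡m (θ⁺ k) 2))
    where
    double : ∀ k → k * (m * k ∸ suc r) ≡ θ⁺ k * 2
    double zero = cong (_* 2) (sym θ⁺-zero)
    double (suc k) = begin
      suc k * (m * suc k ∸ suc r)                  ≡⟨ cong (λ t → suc k * (t ∸ suc r)) (split r k) ⟩
      suc k * (suc r + (2 + m * k) ∸ suc r)        ≡⟨ cong (suc k *_) (ℕ.m+n∸m≡n (suc r) (2 + m * k)) ⟩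
      suc k * (2 + m * k)                          ≡⟨ expand r k ⟩
      m * (k * k) + m * k + 2 + 2 * k              ≡⟨ cong (λ t → m * t + m * k + 2 + 2 * k) (C2-double k) ⟨
      m * (k C 2 + k C 2 + k) + m * k + 2 + 2 * k  ≡⟨ collect r k (k C 2) ⟩
      (m * (k C 2 + k) + suc k) * 2                ≡⟨ cong (λ t → (m * t + suc k) * 2) (C2-suc k) ⟨
      θ⁺ (suc k) * 2                               ∎
      where
      open ≡-Reasoning
      split : ∀ r k → (3 + r) * suc k ≡ suc r + (2 + (3 + r) * k)
      split = solve-∀
      expand : ∀ r k → suc k * (2 + (3 + r) * k) ≡ (3 + r) * (k * k) + (3 + r) * k + 2 + 2 * k
      expand = solve-∀
      collect : ∀ r k t → (3 + r) * (t + t + k) + (3 + r) * k + 2 + 2 * k ≡ ((3 + r) * (t + k) + suc k) * 2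
      collect = solve-∀

  Q≡θ⁻ : ∀ k → Q (m + 2) k ≡ θ⁻ k
  Q≡θ⁻ k = trans (cong₂ (λ a b → (k * (a * k + b)) / 2) g∸2 g∸4)
                 (trans (cong (_/ 2) double) (m*n/n≡m (θ⁻ k) 2))
    where
    open ≡-Reasoning
    double : k * (m * k + suc r) ≡ θ⁻ k * 2
    double = begin
      k * (m * k + suc r)                  ≡⟨ expand r k ⟩
      m * (k * k) + suc r * k              ≡⟨ cong (λ t → m * t + suc r * k) (C2-double k) ⟨
      m * (k C 2 + k C 2 + k) + suc r * k  ≡⟨ collect r k (k C 2) ⟩
      θ⁻ k * 2                             ∎
      where
      expand : ∀ r k → k * ((3 + r) * k + suc r) ≡ (3 + r) * (k * k) + suc r * k
      expand = solve-∀
      collect : ∀ r k t → (3 + r) * (t + t + k) + suc r * k ≡ ((3 + r) * t + suc (suc r) * k) * 2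
      collect = solve-∀

  θ⁺-suc : ∀ k → θ⁺ (suc k) ≡ θ⁺ k + suc (m * k)
  θ⁺-suc k = trans (cong (λ t → m * t + suc k) (C2-suc k)) (regroup r k (k C 2))
    where
    regroup : ∀ r k t → (3 + r) * (t + k) + suc k ≡ (3 + r) * t + k + suc ((3 + r) * k)
    regroup = solve-∀

  θ⁻-θ⁺ : ∀ k → θ⁻ k ≡ θ⁺ k + suc r * k
  θ⁻-θ⁺ k = regroup r k (k C 2)
    where
    regroup : ∀ r k t → (3 + r) * t + suc (suc r) * k ≡ (3 + r) * t + k + suc r * k
    regroup = solve-∀

  θ⁺-suc-θ⁻ : ∀ k → θ⁺ (suc k) ≡ θ⁻ k + suc (2 * k)
  θ⁺-suc-θ⁻ k = trans (θ⁺-suc k) (trans (regroup r k (θ⁺ k)) (cong (_+ suc (2 * k)) (sym (θ⁻-θ⁺ k))))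
    where
    regroup : ∀ r k t → t + suc ((3 + r) * k) ≡ t + suc r * k + suc (2 * k)
    regroup = solve-∀

  θ⁺-step : ∀ k → θ⁺ k < θ⁺ (suc k)
  θ⁺-step k = subst (θ⁺ k <_) (sym (θ⁺-suc k)) (ℕ.m<m+n (θ⁺ k) ℕ.z<s)

  θ⁺<θ⁻ : ∀ k → θ⁺ (suc k) < θ⁻ (suc k)
  θ⁺<θ⁻ k = subst (θ⁺ (suc k) <_) (sym (θ⁻-θ⁺ (suc k))) (ℕ.m<m+n (θ⁺ (suc k)) ℕ.z<s)

  θ⁻<θ⁺ : ∀ k → θ⁻ k < θ⁺ (suc k)
  θ⁻<θ⁺ k = subst (θ⁻ k <_) (sym (θ⁺-suc-θ⁻ k)) (ℕ.m<m+n (θ⁻ k) ℕ.z<s)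

  θ⁻-step : ∀ k → θ⁻ k < θ⁻ (suc k)
  θ⁻-step k = ℕ.<-trans (θ⁻<θ⁺ k) (θ⁺<θ⁻ k)

  θ⁺≢θ⁻ : ∀ a b → θ⁺ (suc a) ≢ θ⁻ (suc b)
  θ⁺≢θ⁻ a b with ℕ.≤-<-connex a b
  ... | inj₁ a≤b = ℕ.<⇒≢ (ℕ.≤-<-trans (step⇒mono θ⁺-step (s≤s a≤b)) (θ⁺<θ⁻ b))
  ... | inj₂ b<a = ℕ.>⇒≢ (ℕ.<-≤-trans (θ⁻<θ⁺ (suc b)) (step⇒mono θ⁺-step (s≤s b<a)))

  Hits : ℕ → ℕ → Set
  Hits i k = θ⁺ k ≡ i ⊎ θ⁻ k ≡ i

  hits-unique : ∀ {i k l} → Hits i (suc k) → Hits i (suc l) → k ≡ l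
  hits-unique (inj₁ p) (inj₁ q) = ℕ.suc-injective (step⇒injective θ⁺-step (trans p (sym q)))
  hits-unique {k = k} {l} (inj₁ p) (inj₂ q) = contradiction (trans p (sym q)) (θ⁺≢θ⁻ k l)
  hits-unique {k = k} {l} (inj₂ p) (inj₁ q) = contradiction (trans q (sym p)) (θ⁺≢θ⁻ l k)
  hits-unique (inj₂ p) (inj₂ q) = ℕ.suc-injective (step⇒injective θ⁻-step (trans p (sym q)))

  signedHits : ℕ → ℕ → ℤ
  signedHits i k = -1ℤ ℤ.^ k ℤ.* ((X ^ θ⁺ k) i ℤ.+ (X ^ θ⁻ k) i)

  signedHits-miss : ∀ {i k} → ¬ Hits i k → signedHits i k ≡ 0ℤ
  signedHits-miss {i} {k} miss =
    trans (cong (-1ℤ ℤ.^ k ℤ.*_) (cong₂ ℤ._+_ (X^-coeff-≢ (miss ∘ inj₁)) (X^-coeff-≢ (miss ∘ inj₂))))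
          (ℤ.*-zeroʳ (-1ℤ ℤ.^ k))

  signedHits-hit : ∀ {i k} → Hits i (suc k) → signedHits i (suc k) ≡ -1ℤ ℤ.^ suc k
  signedHits-hit {i} {k} hit = trans (cong (-1ℤ ℤ.^ suc k ℤ.*_) (one hit)) (ℤ.*-identityʳ (-1ℤ ℤ.^ suc k))
    where
    one : Hits i (suc k) → (X ^ θ⁺ (suc k)) i ℤ.+ (X ^ θ⁻ (suc k)) i ≡ 1ℤ
    one (inj₁ refl) = cong₂ ℤ._+_ (X^-coeff-self (θ⁺ (suc k))) (X^-coeff-≢ (θ⁺≢θ⁻ k k ∘ sym))
    one (inj₂ refl) = cong₂ ℤ._+_ (X^-coeff-≢ (θ⁺≢θ⁻ k k)) (X^-coeff-self (θ⁻ (suc k)))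

  -- findK returns the first index that hits, and by hits-unique no later index does.
  ∑-findK : ∀ i n (h : ℕ → ℕ) → (∀ {a b} → h a ≡ h b → a ≡ b) →
            ∑ n (λ k → signedHits i (suc (h k))) ≡
              maybe (λ k → -1ℤ ℤ.^ k) (+ 0) (findK (m + 2) i (applyUpTo (suc ∘ h) n))
  ∑-findK i zero h _ = refl
  ∑-findK i (suc n) h h-inj with (P (m + 2) (suc (h 0)) ℕ.≟ i) ⊎-dec (Q (m + 2) (suc (h 0)) ℕ.≟ i)
  ... | yes found = trans (cong₂ ℤ._+_ (signedHits-hit hit) (∑-ε n (λ {k} _ → misses k)))
                          (ℤ.+-identityʳ (-1ℤ ℤ.^ suc (h 0)))
    where
    hit : Hits i (suc (h 0))
    hit = Sum.map (trans (sym (P≡θ⁺ (suc (h 0))))) (trans (sym (Q≡θ⁻ (suc (h 0))))) found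
    misses : ∀ k → signedHits i (suc (h (suc k))) ≡ 0ℤ
    misses k = signedHits-miss {i} {suc (h (suc k))} (ℕ.0≢1+n ∘ h-inj ∘ hits-unique hit)
  ... | no missing = trans (cong (ℤ._+ rest) (signedHits-miss {i} {suc (h 0)} (missing ∘ toPQ)))
                           (trans (ℤ.+-identityˡ rest) (∑-findK i n (h ∘ suc) (ℕ.suc-injective ∘ h-inj)))
    where
    rest : ℤ
    rest = ∑ n (λ k → signedHits i (suc (h (suc k))))
    toPQ : Hits i (suc (h 0)) → P (m + 2) (suc (h 0)) ≡ i ⊎ Q (m + 2) (suc (h 0)) ≡ i
    toPQ = Sum.map (trans (P≡θ⁺ (suc (h 0)))) (trans (Q≡θ⁻ (suc (h 0))))

  theta-coeff-sums : ∀ M i → theta M i ≡ ∑ (suc M) (λ k → -1ℤ ℤ.^ k ℤ.* (X ^ θ⁺ k) i)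
                                         ℤ.+ ∑ M (λ j → -1ℤ ℤ.^ suc j ℤ.* (X ^ θ⁻ (suc j)) i)
  theta-coeff-sums M i = cong₂ ℤ._+_
    (trans (∑ₛ-coeff (suc M) (λ k → sign k ⊛ X ^ θ⁺ k) i)
           (∑-cong (suc M) (λ {k} _ → sign-⊛-coeff k (X ^ θ⁺ k) i)))
    (trans (∑ₛ-coeff M (λ j → sign (suc j) ⊛ X ^ θ⁻ (suc j)) i)
           (∑-cong M (λ {j} _ → sign-⊛-coeff (suc j) (X ^ θ⁻ (suc j)) i)))

  theta-coeff-zero : ∀ M → theta M 0 ≡ 1ℤ
  theta-coeff-zero M = trans (theta-coeff-sums M 0)
    (cong₂ ℤ._+_ (cong₂ ℤ._+_ (cong (λ t → 1ℤ ℤ.* (X ^ t) 0) θ⁺-zero)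
                              (∑-ε M (λ {k} _ → vanish (θ⁺-≥ (suc k)))))
                 (∑-ε M (λ {j} _ → vanish (θ⁻-≥ (suc j)))))
    where
    vanish : ∀ {k E} → suc k ≤ E → -1ℤ ℤ.^ suc k ℤ.* (X ^ E) 0 ≡ 0ℤ
    vanish {k} {E} 1+k≤E = trans (cong (-1ℤ ℤ.^ suc k ℤ.*_) (coeff< (X^≈[]0 E) (ℕ.<-≤-trans ℕ.z<s 1+k≤E)))
                                  (ℤ.*-zeroʳ (-1ℤ ℤ.^ suc k))

  theta-coeff-suc : ∀ M i → theta M (suc i) ≡ ∑ M (λ k → signedHits (suc i) (suc k))
  theta-coeff-suc M i = begin
    theta M (suc i)
      ≡⟨ theta-coeff-sums M (suc i) ⟩
    (1ℤ ℤ.* (X ^ θ⁺ 0) (suc i) ℤ.+ ∑ M a⁺) ℤ.+ ∑ M a⁻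
      ≡⟨ cong (λ t → (1ℤ ℤ.* (X ^ t) (suc i) ℤ.+ ∑ M a⁺) ℤ.+ ∑ M a⁻) θ⁺-zero ⟩
    (0ℤ ℤ.+ ∑ M a⁺) ℤ.+ ∑ M a⁻
      ≡⟨ cong (ℤ._+ ∑ M a⁻) (ℤ.+-identityˡ (∑ M a⁺)) ⟩
    ∑ M a⁺ ℤ.+ ∑ M a⁻
      ≡⟨ ∑-distrib M a⁺ a⁻ ⟨
    ∑ M (λ k → a⁺ k ℤ.+ a⁻ k)
      ≡⟨ ∑-cong M (λ {k} _ → sym (ℤ.*-distribˡ-+ (-1ℤ ℤ.^ suc k) _ _)) ⟩
    ∑ M (λ k → signedHits (suc i) (suc k)) ∎
    where
    open ≡-Reasoning
    a⁺ a⁻ : ℕ → ℤ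
    a⁺ k = -1ℤ ℤ.^ suc k ℤ.* (X ^ θ⁺ (suc k)) (suc i)
    a⁻ k = -1ℤ ℤ.^ suc k ℤ.* (X ^ θ⁻ (suc k)) (suc i)

  theta-coeff : ∀ M i → i ≤ M → theta M i ≡ e (m + 2) i
  theta-coeff M zero _ = theta-coeff-zero M
  theta-coeff M (suc i) i<M with ℕ.m≤n⇒∃[o]m+o≡n i<M
  ... | t , refl = begin
    theta (suc i + t) (suc i)
      ≡⟨ theta-coeff-suc (suc i + t) i ⟩
    ∑ (suc i + t) hits
      ≡⟨ ∑-split (suc i) t hits ⟩
    ∑ (suc i) hits ℤ.+ ∑ t (λ k → hits (suc i + k))
      ≡⟨ cong (ℤ._+_ (∑ (suc i) hits)) (∑-ε t (λ {k} _ → beyond k)) ⟩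
    ∑ (suc i) hits ℤ.+ 0ℤ
      ≡⟨ ℤ.+-identityʳ (∑ (suc i) hits) ⟩
    ∑ (suc i) hits
      ≡⟨ ∑-findK (suc i) (suc i) (λ k → k) (λ a≡b → a≡b) ⟩
    value (applyUpTo suc (suc i))
      ≡⟨ cong value (map-applyUpTo suc (λ k → k) (suc i)) ⟨
    e (m + 2) (suc i) ∎
    where
    open ≡-Reasoning
    hits : ℕ → ℤ
    hits k = signedHits (suc i) (suc k)
    value : List ℕ → ℤ
    value ks = maybe (λ k → -1ℤ ℤ.^ k) (+ 0) (findK (m + 2) (suc i) ks)
    too-large : ∀ k → suc (suc i + k) ≰ suc i
    too-large k = ℕ.<⇒≱ (s≤s (ℕ.m≤m+n (suc i) k))
    beyond : ∀ k → hits (suc i + k) ≡ 0ℤ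
    beyond k = signedHits-miss {suc i} {suc (suc i + k)} λ where
      (inj₁ θ≡i) → too-large k (subst (suc (suc i + k) ≤_) θ≡i (θ⁺-≥ (suc (suc i + k))))
      (inj₂ θ≡i) → too-large k (subst (suc (suc i + k) ≤_) θ≡i (θ⁻-≥ (suc (suc i + k))))

module Divisors (r : ℕ) where

  open import Defs using (σ′)
  open LogarithmicDerivative using (H; H-coeff-∣; H-coeff-∤)
  open FiniteSums using (∑; ∑-cong; ∑-ε; ∑-split; ∑-blocks; ∑-three; sum-filter; map-applyUpTo)
  open import Data.Bool using (if_then_else_)
  open import Data.Integer as ℤ using (ℤ; +_; 0ℤ)
  open import Data.List using (filter)
  open import Data.Nat as ℕ using (ℕ; zero; suc; _+_; _*_; _∸_; _<_; _≤_; s≤s)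
  open import Data.Nat.Divisibility using (_∣_; _∣?_; ∣⇒≤; ∣m+n∣m⇒∣n; m∣m*n)
  open import Data.Nat.ListAction using () renaming (sum to sumℕ)
  open import Data.Nat.Tactic.RingSolver using (solve-∀)
  open import Data.Product using (_×_; _,_; proj₁; proj₂)
  open import Data.Sum using (_⊎_; inj₁; inj₂)
  open import Relation.Nullary using (¬_; Dec; does; yes; no)
  open import Relation.Nullary.Decidable using (_⊎-dec_; _×-dec_; dec-true; dec-false)

  m : ℕ
  m = 3 + r

  Special : ℕ → Set
  Special d = m ∣ d ⊎ m ∣ d ∸ 1 ⊎ m ∣ suc d

  special? : ∀ d → Dec (Special d)
  special? d = m ∣? d ⊎-dec (m ∣? (d ∸ 1) ⊎-dec m ∣? suc d)

  counted? : ∀ i d → Dec (d ∣ i × Special d)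
  counted? i d = d ∣? i ×-dec special? d

  σ′-summand : ℕ → ℕ → ℤ
  σ′-summand i d = if does (counted? i d) then + d else 0ℤ

  σ′-∑ : ∀ i → + σ′ m i ≡ ∑ i (λ d → σ′-summand i (suc d))
  σ′-∑ i = trans (cong (λ ds → + sumℕ (filter (counted? i) ds)) (map-applyUpTo suc (λ d → d) i))
                 (sum-filter (counted? i) i suc)

  σ′-summand-special : ∀ {i d} → Special d → σ′-summand (suc i) d ≡ H d (suc i)
  σ′-summand-special {i} {d} s = byCases (d ∣? suc i)
    where
    byCases : Dec (d ∣ suc i) → σ′-summand (suc i) d ≡ H d (suc i)
    byCases (yes d∣i) = trans (cong (if_then + d else 0ℤ) (dec-true (counted? (suc i) d) (d∣i , s)))
                              (sym (H-coeff-∣ d∣i))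
    byCases (no d∤i) = trans (cong (if_then + d else 0ℤ) (dec-false (counted? (suc i) d) (d∤i ∘ proj₁)))
                             (sym (H-coeff-∤ d∤i))

  σ′-summand-ordinary : ∀ {i d} → ¬ Special d → σ′-summand i d ≡ 0ℤ
  σ′-summand-ordinary {i} {d} ¬s = cong (if_then + d else 0ℤ) (dec-false (counted? i d) (¬s ∘ proj₂))

  σ′-summand-large : ∀ {i d} → suc i < d → σ′-summand (suc i) d ≡ 0ℤ
  σ′-summand-large {i} {d} i<d =
    cong (if_then + d else 0ℤ) (dec-false (counted? (suc i) d) (ℕ.<⇒≱ i<d ∘ ∣⇒≤ ∘ proj₁))

  m∤ : ∀ k {t} → 0 < t → t < m → ¬ m ∣ m * k + t
  m∤ k {suc t} _ t<m m∣mk+t = ℕ.<⇒≱ t<m (∣⇒≤ (∣m+n∣m⇒∣n m∣mk+t (m∣m*n k)))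

  -- In the block m k + 1, …, m k + m only m k + 1, m k + m - 1 and m k + m are special.
  block : ∀ i k → ∑ m (λ j → σ′-summand (suc i) (suc (m * k + j))) ≡
                  H (suc (m * k)) (suc i) ℤ.+ H (m * k + suc (suc r)) (suc i) ℤ.+ H (m * suc k) (suc i)
  block i k = trans (∑-three r W ordinary) (cong₂ ℤ._+_ (cong₂ ℤ._+_ first middle) last)
    where
    W : ℕ → ℤ
    W j = σ′-summand (suc i) (suc (m * k + j))

    d≡ : ∀ j → suc (m * k + suc j) ≡ m * k + suc (suc j)
    d≡ j = sym (ℕ.+-suc (m * k) (suc j))

    1+d≡ : ∀ j → suc (suc (m * k + suc j)) ≡ m * k + suc (suc (suc j))
    1+d≡ j = sym (trans (ℕ.+-suc (m * k) (2 + j)) (cong suc (ℕ.+-suc (m * k) (suc j))))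

    ordinary : ∀ {j} → j < r → W (suc j) ≡ 0ℤ
    ordinary {j} j<r = σ′-summand-ordinary {suc i} λ where
      (inj₁ m∣d) → m∤ k ℕ.z<s (s≤s (s≤s (ℕ.m<n⇒m<1+n j<r))) (subst (m ∣_) (d≡ j) m∣d)
      (inj₂ (inj₁ m∣d-1)) → m∤ k ℕ.z<s (s≤s (ℕ.m<n⇒m<1+n (ℕ.m<n⇒m<1+n j<r))) m∣d-1
      (inj₂ (inj₂ m∣d+1)) → m∤ k ℕ.z<s (s≤s (s≤s (s≤s j<r))) (subst (m ∣_) (1+d≡ j) m∣d+1)

    first : W 0 ≡ H (suc (m * k)) (suc i)
    first = trans (σ′-summand-special (inj₂ (inj₁ (subst (m ∣_) (sym (ℕ.+-identityʳ (m * k))) (m∣m*n k)))))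
                  (cong (λ d → H (suc d) (suc i)) (ℕ.+-identityʳ (m * k)))

    middle : W (suc r) ≡ H (m * k + suc (suc r)) (suc i)
    middle = trans (σ′-summand-special (inj₂ (inj₂ (subst (m ∣_) (shift r k) (m∣m*n (suc k))))))
                   (cong (λ d → H d (suc i)) (sym (ℕ.+-suc (m * k) (suc r))))
      where
      shift : ∀ r k → (3 + r) * suc k ≡ suc (suc ((3 + r) * k + suc r))
      shift = solve-∀

    last : W (suc (suc r)) ≡ H (m * suc k) (suc i)
    last = trans (σ′-summand-special (inj₁ (subst (m ∣_) (shift r k) (m∣m*n (suc k)))))
                 (cong (λ d → H d (suc i)) (sym (shift r k)))
      where
      shift : ∀ r k → (3 + r) * suc k ≡ suc ((3 + r) * k + suc (suc r))
      shift = solve-∀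

  H-sum-σ′ : ∀ M i → i ≤ M →
             ∑ M (λ k → H (suc (m * k)) i ℤ.+ H (m * k + suc (suc r)) i ℤ.+ H (m * suc k) i) ≡ + σ′ m i
  H-sum-σ′ M zero _ = ∑-ε M (λ _ → refl)
  H-sum-σ′ M (suc i) i<M = begin
    ∑ M (λ k → H (suc (m * k)) (suc i) ℤ.+ H (m * k + suc (suc r)) (suc i) ℤ.+ H (m * suc k) (suc i))
      ≡⟨ ∑-cong M (λ {k} _ → sym (block i k)) ⟩
    ∑ M (λ k → ∑ m (λ j → S (m * k + j)))
      ≡⟨ ∑-blocks m M S ⟨
    ∑ (m * M) S
      ≡⟨ cong (λ n → ∑ n S) (ℕ.m+[n∸m]≡n i≤mM) ⟨
    ∑ (suc i + t) S
      ≡⟨ ∑-split (suc i) t S ⟩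
    ∑ (suc i) S ℤ.+ ∑ t (λ d → S (suc i + d))
      ≡⟨ cong (ℤ._+_ (∑ (suc i) S)) (∑-ε t (λ {d} _ → beyond d)) ⟩
    ∑ (suc i) S ℤ.+ 0ℤ
      ≡⟨ ℤ.+-identityʳ (∑ (suc i) S) ⟩
    ∑ (suc i) S
      ≡⟨ σ′-∑ (suc i) ⟨
    + σ′ m (suc i) ∎
    where
    open ≡-Reasoning
    S : ℕ → ℤ
    S d = σ′-summand (suc i) (suc d)
    beyond : ∀ d → S (suc i + d) ≡ 0ℤ
    beyond d = σ′-summand-large (s≤s (s≤s (ℕ.m≤m+n i d)))
    i≤mM : suc i ≤ m * M
    i≤mM = ℕ.≤-trans i<M (ℕ.m≤n*m M m)
    t : ℕ
    t = m * M ∸ suc i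

module BellPolynomials where

  open import Defs using (bellVec; Bell)
  open RangeSum using (module SumDistrib)
  open FiniteSums using (∑; ∑-cong)
  open import Data.Fin as Fin using (Fin; toℕ)
  open import Data.Integer as ℤ using (ℤ; +_; -_; _+_; _*_; 0ℤ; 1ℤ)
  open import Data.Integer.Tactic.RingSolver using (solve-∀)
  open import Data.Nat as ℕ using (ℕ; zero; suc; _∸_; _<_; _≤_; s≤s; _!; NonZero)
  open import Data.Nat.Combinatorics using (_C_; nCk≡n!/k![n-k]!; k![n∸k]!∣n!)
  open import Data.Nat.DivMod using (m/n*n≡m)
  open import Data.Nat.Induction using (<-rec)
  open import Data.Vec as Vec using (Vec; _∷_; lookup; tabulate; zipWith)

  open import Algebra.Properties.Monoid.Sum ℤ.+-0-monoid using (sum-cong-≗) renaming (sum to sumᶠ)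
  open SumDistrib ℤ.+-*-semiring using (∑-distribˡ)

  foldr-zipWith-tabulate : ∀ {A : Set} n (G : A → ℤ → ℤ) (t : Fin n → A) (v : Vec ℤ n) →
    Vec.foldr (λ _ → ℤ) _+_ 0ℤ (zipWith G (tabulate t) v) ≡ sumᶠ (λ k → G (t k) (lookup v k))
  foldr-zipWith-tabulate zero G t Vec.[] = refl
  foldr-zipWith-tabulate (suc n) G t (b ∷ v) = cong (_+_ (G (t Fin.zero) b)) (foldr-zipWith-tabulate n G (t ∘ Fin.suc) v)

  sumᶠ-toℕ : ∀ n (φ : ℕ → ℤ) → sumᶠ {n} (φ ∘ toℕ) ≡ ∑ n φ
  sumᶠ-toℕ zero φ = refl
  sumᶠ-toℕ (suc n) φ = cong (_+_ (φ 0)) (sumᶠ-toℕ n (φ ∘ suc))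

  bellVec-lookup : ∀ n x (k : Fin (suc n)) → lookup (bellVec n x) k ≡ Bell (n ∸ toℕ k) x
  bellVec-lookup zero x Fin.zero = refl
  bellVec-lookup (suc n) x Fin.zero = refl
  bellVec-lookup (suc n) x (Fin.suc k) = bellVec-lookup n x k

  Bell-suc : ∀ n x → Bell (suc n) x ≡ ∑ (suc n) (λ k → + (n C k) * x (suc k) * Bell (n ∸ k) x)
  Bell-suc n x = begin
    Bell (suc n) x
      ≡⟨ foldr-zipWith-tabulate (suc n) G (λ k → k) (bellVec n x) ⟩
    sumᶠ {suc n} (λ k → G k (lookup (bellVec n x) k))
      ≡⟨ sum-cong-≗ (λ k → cong (G k) (bellVec-lookup n x k)) ⟩
    sumᶠ {suc n} (λ k → φ (toℕ k))
      ≡⟨ sumᶠ-toℕ (suc n) φ ⟩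
    ∑ (suc n) φ ∎
    where
    open ≡-Reasoning
    G : Fin (suc n) → ℤ → ℤ
    G k b = + (n C toℕ k) * x (suc (toℕ k)) * b
    φ : ℕ → ℤ
    φ k = + (n C k) * x (suc k) * Bell (n ∸ k) x

  choose-factorials : ∀ {n k} → k ≤ n → (n C k) ℕ.* (k ! ℕ.* (n ∸ k) !) ≡ n !
  choose-factorials {n} {k} k≤n =
    trans (cong (ℕ._* (k ! ℕ.* (n ∸ k) !)) (nCk≡n!/k![n-k]! k≤n)) (m/n*n≡m (k![n∸k]!∣n! k≤n))
    where
    instance
      nonZero : NonZero (k ! ℕ.* (n ∸ k) !)
      nonZero = k ℕ.!* (n ∸ k) !≢0

  -- The recurrence says X E′ = -(Σ_j s_j X^j) E, i.e. E = exp (-Σ_j s_j X^j / j).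
  bell-exponential : ∀ (s E : ℕ → ℤ) → E 0 ≡ 1ℤ →
                     (∀ n → + suc n * E (suc n) ≡ - ∑ (suc n) (λ k → s (suc k) * E (n ∸ k))) →
                     ∀ n → Bell n (λ j → - (+ ((j ∸ 1) !) * s j)) ≡ + (n !) * E n
  bell-exponential s E E0≡1 recurrence = <-rec _ step
    where
    x : ℕ → ℤ
    x j = - (+ ((j ∸ 1) !) * s j)

    step : ∀ n → (∀ {j} → j < n → Bell j x ≡ + (j !) * E j) → Bell n x ≡ + (n !) * E n
    step zero _ = sym (trans (ℤ.*-identityˡ (E 0)) E0≡1)
    step (suc n) ih = begin
      Bell (suc n) x
        ≡⟨ Bell-suc n x ⟩
      ∑ (suc n) (λ k → + (n C k) * x (suc k) * Bell (n ∸ k) x)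
        ≡⟨ ∑-cong (suc n) (λ {k} k<1+n → term k (ℕ.≤-pred k<1+n)) ⟩
      ∑ (suc n) (λ k → - + (n !) * (s (suc k) * E (n ∸ k)))
        ≡⟨ ∑-distribˡ (suc n) (λ k → s (suc k) * E (n ∸ k)) (- + (n !)) ⟨
      - + (n !) * ∑ (suc n) (λ k → s (suc k) * E (n ∸ k))
        ≡⟨ cong (λ t → - + (n !) * t) (trans (sym (ℤ.neg-involutive _)) (cong -_ (sym (recurrence n)))) ⟩
      - + (n !) * - (+ suc n * E (suc n))
        ≡⟨ cancel (+ (n !)) (+ suc n) (E (suc n)) ⟩
      + suc n * + (n !) * E (suc n)
        ≡⟨ cong (_* E (suc n)) (ℤ.pos-* (suc n) (n !)) ⟨
      + (suc n !) * E (suc n) ∎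
      where
      open ≡-Reasoning
      cancel : ∀ a b c → - a * - (b * c) ≡ b * a * c
      cancel = solve-∀
      regroup : ∀ a b c t u → a * - (b * t) * (c * u) ≡ - (a * (b * c)) * (t * u)
      regroup = solve-∀
      term : ∀ k → k ≤ n → + (n C k) * x (suc k) * Bell (n ∸ k) x ≡ - + (n !) * (s (suc k) * E (n ∸ k))
      term k k≤n = begin
        + (n C k) * x (suc k) * Bell (n ∸ k) x
          ≡⟨ cong (+ (n C k) * x (suc k) *_) (ih (s≤s (ℕ.m∸n≤m n k))) ⟩
        + (n C k) * x (suc k) * (+ ((n ∸ k) !) * E (n ∸ k))
          ≡⟨ regroup (+ (n C k)) (+ (k !)) (+ ((n ∸ k) !)) (s (suc k)) (E (n ∸ k)) ⟩
        - (+ (n C k) * (+ (k !) * + ((n ∸ k) !))) * (s (suc k) * E (n ∸ k))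
          ≡⟨ cong (λ t → - t * (s (suc k) * E (n ∸ k))) factorials ⟩
        - + (n !) * (s (suc k) * E (n ∸ k)) ∎
        where
        factorials : + (n C k) * (+ (k !) * + ((n ∸ k) !)) ≡ + (n !)
        factorials = trans (cong (+ (n C k) *_) (sym (ℤ.pos-* (k !) ((n ∸ k) !))))
                           (trans (sym (ℤ.pos-* (n C k) (k ! ℕ.* (n ∸ k) !))) (cong +_ (choose-factorials k≤n)))

module Recurrence (r : ℕ) where

  open import Defs using (e; σ′)
  open PowerSeries
  open Truncation
  open FiniteSums
  open LogarithmicDerivative
  open import Data.Integer as ℤ using (ℤ; +_; -_)
  import Data.Integer.Tactic.RingSolver as ℤ-Solver
  open import Data.Nat as ℕ using (ℕ; suc; _+_; _*_; _∸_)

  open import Algebra.Properties.Ring (CommutativeRing.ring SeriesRing) using (-‿distribˡ-*)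
  open TripleProduct (suc r)
  open ThetaCoefficients r using (theta-coeff)
  open Divisors r using (H-sum-σ′)

  E σₘ : Series
  E = e (m + 2)
  σₘ i = + σ′ m i

  E≈jacobiProduct : ∀ M → E ≈[ suc M ] jacobiProduct M
  E≈jacobiProduct M = ≈[]-trans (below λ {i} i≤M → sym (theta-coeff M i (ℕ.≤-pred i≤M)))
                                (≈[]-sym (jacobiProduct≈theta M))

  jacobiLogDerivative≈σ : ∀ M → jacobiLogDerivative M ≈[ suc M ] ⊝ σₘ
  jacobiLogDerivative≈σ M = below λ {i} i≤M → begin
    jacobiLogDerivative M i
      ≡⟨ ∑ₛ-coeff M _ i ⟩
    ∑ M (λ k → - H₁ k i ℤ.+ - H₂ k i ℤ.+ - H₃ k i)
      ≡⟨ ∑-cong M (λ {k} _ → neg₃ (H₁ k i) (H₂ k i) (H₃ k i)) ⟩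
    ∑ M (λ k → - (H₁ k i ℤ.+ H₂ k i ℤ.+ H₃ k i))
      ≡⟨ ∑-neg M _ ⟩
    - ∑ M (λ k → H₁ k i ℤ.+ H₂ k i ℤ.+ H₃ k i)
      ≡⟨ cong -_ (H-sum-σ′ M i (ℕ.≤-pred i≤M)) ⟩
    - σₘ i ∎
    where
    open ≡-Reasoning
    H₁ H₂ H₃ : ℕ → Series
    H₁ k = H (suc (m * k))
    H₂ k = H (m * k + suc (suc r))
    H₃ k = H (m * suc k)
    neg₃ : ∀ a b c → - a ℤ.+ - b ℤ.+ - c ≡ - (a ℤ.+ b ℤ.+ c)
    neg₃ = ℤ-Solver.solve-∀

  -- The constant term σₘ 0 = + σ′ m 0 reduces to 0, so it drops out of (σₘ ⊛ E) (suc n).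
  e-recurrence : ∀ n → + suc n ℤ.* E (suc n) ≡ - ∑ (suc n) (λ k → σₘ (suc k) ℤ.* E (n ∸ k))
  e-recurrence n = begin
    xD E (suc n)        ≡⟨ coeff< xD-E (ℕ.n<1+n (suc n)) ⟩
    (⊝ σₘ ⊛ E) (suc n)  ≡⟨ coeff (-‿distribˡ-* σₘ E) (suc n) ⟨
    - (σₘ ⊛ E) (suc n)  ≡⟨ cong -_ (trans (ℤ.+-identityˡ _) (⊛-coeff-∑ (σₘ ∘ suc) E n)) ⟩
    - ∑ (suc n) (λ k → σₘ (suc k) ℤ.* E (n ∸ k)) ∎
    where
    open ≡-Reasoning
    xD-E : xD E ≈[ 2 + n ] ⊝ σₘ ⊛ E
    xD-E = ≈[]-trans (xD-≈[] (E≈jacobiProduct (suc n)))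
             (≈[]-trans (≋⇒≈[] _ (jacobiProduct-logDerivative (suc n)))
                        (≈[]-⊛ (jacobiLogDerivative≈σ (suc n)) (≈[]-sym (E≈jacobiProduct (suc n)))))

open import Defs
open import Data.Nat using (ℕ; _≤_; _+_)
open import Data.Nat using (_!)
open import Data.Integer using (+_; _*_)
open import Relation.Binary.PropositionalEquality using (_≡_; refl)
open import Data.Nat.Properties using (m≤n⇒∃[o]m+o≡n)
open import Data.Product using (_,_)
open BellPolynomials using (bell-exponential)

theorem11 : (n m : ℕ) → 1 ≤ n → 3 ≤ m →
    Bell n (dseq m) ≡ (+ (n !)) * e (m + 2) n
theorem11 n m _ 3≤m with m≤n⇒∃[o]m+o≡n 3≤m
... | r , refl = bell-exponential (Recurrence.σₘ r) (Recurrence.E r) refl (Recurrence.e-recurrence r) n
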